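{- Let $M=(S,T,I,L)$ be a Kripke structure and $\psi$ an LTL formula in positive normal form. Then $M$ has an initialised infinite path $\pi$ such that $\pi\models\psi$ if and only if there exists $k\in\mathbb{N}$ such that the Büchi encoding $[\![M,\psi,k]\!]$ is satisfiable. In particular, if $\pi$ is an initialised infinite path of $M$ with $\pi\models_k\psi$, then $[\![M,\psi,k]\!]$ is satisfiable.
   Context: Kripke structures: $AP$ is a set of atomic propositions; $M=(S,T,I,L)$ has a finite set of states $S$ (valuations of finitely many Boolean state variables), total transition relation $T\subseteq S\times S$, initial states $I$, labelling $L:S\to2^{AP}$. An infinite path $\pi=s_0s_1\ldots$ is initialised if $s_0\in I$. LTL in positive normal form: built from $p,\neg p$ ($p\in AP$) with $\wedge,\vee,\mathbf{X},\mathbf{U},\mathbf{R}$ with standard semantics ($\pi^i\models\psi_1\mathbf{U}\psi_2$ iff $\exists j\ge i$: $\pi^j\models\psi_2$ and $\pi^n\models\psi_1$ for $i\le n<j$; $\pi^i\models\psi_1\mathbf{R}\psi_2$ iff $\forall j\ge i$: $\pi^j\models\psi_2$ or $\pi^n\models\psi_1$ for some $i\le n<j$; $\pi^i\models\mathbf{X}\psi_1$ iff $\pi^{i+1}\models\psi_1$). $\mathit{cl}(\psi)$: set of subformulas. Bounded semantics: $\pi$ is a $(k,l)$-loop if $\pi=(s_0\ldots s_{l-1})(s_l\ldots s_k)^\omega$ with $0<l\le k$, $s_{l-1}=s_k$. $\pi\models_k\psi$ iff (a) $\pi$ is a $(k,l)$-loop for some $0<l\le k$ and $\pi^0\models\psi$,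 or (b) $\pi^0\models^{nl}_k\psi$, where $\models^{nl}_k$ agrees with $\models$ on $p,\neg p,\wedge,\vee$ and: $\pi^i\models^{nl}_k\mathbf{X}\psi_1$ iff $i<k$ and $\pi^{i+1}\models^{nl}_k\psi_1$; $\pi^i\models^{nl}_k\psi_1\mathbf{U}\psi_2$ iff $\exists i\le j\le k$: $\pi^j\models^{nl}_k\psi_2$ and $\pi^n\models^{nl}_k\psi_1$ for $i\le n<j$; $\pi^i\models^{nl}_k\psi_1\mathbf{R}\psi_2$ iff $\exists i\le j\le k$: $\pi^j\models^{nl}_k\psi_1$ and $\pi^n\models^{nl}_k\psi_2$ for $i\le n\le j$. Encoding. Propositional copies $s_0..s_k$ of state variables; $[\![M]\!]_k=I(s_0)\wedge\bigwedge_{i=1}^kT(s_{i-1},s_i)$. Loop constraints (fresh $l_0..l_k$, $\mathit{InLoop}_0..\mathit{InLoop}_k$, $\mathit{LoopExists}$): $l_0\Leftrightarrow\bot$, $\mathit{InLoop}_0\Leftrightarrow\bot$; for $1\le i\le k$: $l_i\Rightarrow(s_{i-1}=s_k)$, $\mathit{InLoop}_i\Leftrightarrow\mathit{InLoop}_{i-1}\vee l_i$, $\mathit{InLoop}_{i-1}\Rightarrow\neg l_i$; $\mathit{LoopExists}\Leftrightarrow\mathit{InLoop}_k$. Fresh variables $[\![\varphi]\!]_i$ for $\varphi\in\mathit{cl}(\psi)$, $0\le i\le k+1$, with: for $0\le i\le k$, $[\![p]\!]_i\Leftrightarrow(p\in L(s_i))$, $[\![\neg p]\!]_i\Leftrightarrow(p\notin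 L(s_i))$, $[\![\psi_1\wedge\psi_2]\!]_i\Leftrightarrow[\![\psi_1]\!]_i\wedge[\![\psi_2]\!]_i$, $[\![\psi_1\vee\psi_2]\!]_i\Leftrightarrow[\![\psi_1]\!]_i\vee[\![\psi_2]\!]_i$, $[\![\mathbf{X}\psi_1]\!]_i\Leftrightarrow[\![\psi_1]\!]_{i+1}$, $[\![\psi_1\mathbf{U}\psi_2]\!]_i\Leftrightarrow[\![\psi_2]\!]_i\vee([\![\psi_1]\!]_i\wedge[\![\psi_1\mathbf{U}\psi_2]\!]_{i+1})$, $[\![\psi_1\mathbf{R}\psi_2]\!]_i\Leftrightarrow[\![\psi_2]\!]_i\wedge([\![\psi_1]\!]_i\vee[\![\psi_1\mathbf{R}\psi_2]\!]_{i+1})$. Last-state constraints for each $\varphi\in\mathit{cl}(\psi)$: $\neg\mathit{LoopExists}\Rightarrow([\![\varphi]\!]_{k+1}\Leftrightarrow\bot)$, and $l_i\Rightarrow([\![\varphi]\!]_{k+1}\Leftrightarrow[\![\varphi]\!]_i)$ for $1\le i\le k$. Büchi acceptance constraints: for each subformula $\varphi=\psi_1\mathbf{U}\psi_2$, fresh $\langle\!\langle Acc(\varphi)\rangle\!\rangle_i$ ($0\le i\le k$) with $\langle\!\langle Acc(\varphi)\rangle\!\rangle_0\Leftrightarrow\bot$, $\mathit{LoopExists}\Rightarrow\langle\!\langle Acc(\varphi)\rangle\!\rangle_k$, and for $1\le i\le k$: $\langle\!\langle Acc(\varphi)\rangle\!\rangle_i\Leftrightarrow\langle\!\langle Acc(\varphi)\rangle\!\rangle_{i-1}\vee(\mathit{InLoop}_i\wedge([\![\psi_2]\!]_i\vee\neg[\![\varphi]\!]_i))$;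 for each subformula $\varphi=\psi_1\mathbf{R}\psi_2$, the same with the last constraint replaced by $\langle\!\langle Acc(\varphi)\rangle\!\rangle_i\Leftrightarrow\langle\!\langle Acc(\varphi)\rangle\!\rangle_{i-1}\vee(\mathit{InLoop}_i\wedge(\neg[\![\psi_2]\!]_i\vee[\![\varphi]\!]_i))$. The Büchi encoding $[\![M,\psi,k]\!]$ is the conjunction of the model constraints, loop constraints, last-state constraints, the formula-variable and Büchi acceptance constraints, and $[\![\psi]\!]_0$. -}

module Defs where

open import Data.Nat using (ℕ; zero; suc; _≤_; _<_; _+_; _∸_)
open import Data.Bool using (Bool; true; false; not; _∧_; _∨_; if_then_else_)
open import Data.Fin using (Fin)
open import Data.Vec using (Vec; lookup)
open import Data.List using (List; []; _∷_; _++_; map; foldr; upTo)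
open import Data.Product using (Σ; _×_; _,_)
open import Data.Sum using (_⊎_; inj₁; inj₂; [_,_])
open import Relation.Binary.PropositionalEquality using (_≡_)

infixr 6 _∧ᵖ_
infixr 5 _∨ᵖ_
infixr 4 _⇒ᵖ_ _⇔ᵖ_

data Prop (V : Set) : Set where
  ⊤ᵖ ⊥ᵖ : Prop V
  varᵖ  : V → Prop V
  ¬ᵖ_   : Prop V → Prop V
  _∧ᵖ_ _∨ᵖ_ _⇒ᵖ_ _⇔ᵖ_ : Prop V → Prop V → Prop V

_⇔ᵇ_ : Bool → Bool → Bool
a ⇔ᵇ b = if a then b else not b

eval : {V : Set} → (V → Bool) → Prop V → Bool
eval σ ⊤ᵖ = true
eval σ ⊥ᵖ = false
eval σ (varᵖ x) = σ x
eval σ (¬ᵖ a) = not (eval σ a)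
eval σ (a ∧ᵖ b) = eval σ a ∧ eval σ b
eval σ (a ∨ᵖ b) = eval σ a ∨ eval σ b
eval σ (a ⇒ᵖ b) = not (eval σ a) ∨ eval σ b
eval σ (a ⇔ᵖ b) = eval σ a ⇔ᵇ eval σ b

rename : {V W : Set} → (V → W) → Prop V → Prop W
rename f ⊤ᵖ = ⊤ᵖ
rename f ⊥ᵖ = ⊥ᵖ
rename f (varᵖ x) = varᵖ (f x)
rename f (¬ᵖ a) = ¬ᵖ rename f a
rename f (a ∧ᵖ b) = rename f a ∧ᵖ rename f b
rename f (a ∨ᵖ b) = rename f a ∨ᵖ rename f b
rename f (a ⇒ᵖ b) = rename f a ⇒ᵖ rename f b
rename f (a ⇔ᵖ b) = rename f a ⇔ᵖ rename f b

⋀ : {V : Set} → List (Prop V) → Prop V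
⋀ = foldr _∧ᵖ_ ⊤ᵖ

Satisfiable : {V : Set} → Prop V → Set
Satisfiable {V} φ = Σ (V → Bool) λ σ → eval σ φ ≡ true

-- States are valuations  Vec Bool n ; I, T and the labelling are
-- propositional formulas over the state variables (T over two copies:
-- inj₁ = current state, inj₂ = next state).

State : ℕ → Set
State n = Vec Bool n

record Kripke (AP : Set) : Set where
  field
    n     : ℕ
    init  : Prop (Fin n)
    trans : Prop (Fin n ⊎ Fin n)
    label : AP → Prop (Fin n)

  I : State n → Set
  I s = eval (lookup s) init ≡ true

  T : State n → State n → Set
  T s s' = eval [ lookup s , lookup s' ] trans ≡ true

  _∈L_ : AP → State n → Set
  p ∈L s = eval (lookup s) (label p) ≡ true

  _∉L_ : AP → State n → Set
  p ∉L s = eval (lookup s) (label p) ≡ false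

  field
    total : (s : State n) → Σ (State n) λ s' → T s s'

infixr 6 _∧ₗ_
infixr 5 _∨ₗ_
infixr 7 _Uₗ_ _Rₗ_

data LTL (AP : Set) : Set where
  pos neg : AP → LTL AP
  _∧ₗ_ _∨ₗ_ : LTL AP → LTL AP → LTL AP
  Xₗ : LTL AP → LTL AP
  _Uₗ_ _Rₗ_ : LTL AP → LTL AP → LTL AP

cl : {AP : Set} → LTL AP → List (LTL AP)
cl (pos p) = pos p ∷ []
cl (neg p) = neg p ∷ []
cl (a ∧ₗ b) = (a ∧ₗ b) ∷ cl a ++ cl b
cl (a ∨ₗ b) = (a ∨ₗ b) ∷ cl a ++ cl b
cl (Xₗ a) = Xₗ a ∷ cl a
cl (a Uₗ b) = (a Uₗ b) ∷ cl a ++ cl b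
cl (a Rₗ b) = (a Rₗ b) ∷ cl a ++ cl b

module _ {AP : Set} (M : Kripke AP) where
  open Kripke M

  Path : Set
  Path = ℕ → State n

  IsPath : Path → Set
  IsPath π = (i : ℕ) → T (π i) (π (suc i))

  InitialisedPath : Path → Set
  InitialisedPath π = I (π 0) × IsPath π

  Sat : Path → ℕ → LTL AP → Set
  Sat π i (pos p) = p ∈L π i
  Sat π i (neg p) = p ∉L π i
  Sat π i (a ∧ₗ b) = Sat π i a × Sat π i b
  Sat π i (a ∨ₗ b) = Sat π i a ⊎ Sat π i b
  Sat π i (Xₗ a) = Sat π (suc i) a
  Sat π i (a Uₗ b) = Σ ℕ λ j → i ≤ j × Sat π j b × ((m : ℕ) → i ≤ m → m < j → Sat π m a)
  Sat π i (a Rₗ b) = (j : ℕ) → i ≤ j → Sat π j b ⊎ Σ ℕ λ m → i ≤ m × m < j × Sat π m a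

  _⊨_ : Path → LTL AP → Set
  π ⊨ ψ = Sat π 0 ψ

  -- π is a (k,l)-loop: π = (s_0 … s_{l-1})(s_l … s_k)^ω with 0<l≤k, s_{l-1}=s_k
  IsLoop : Path → ℕ → ℕ → Set
  IsLoop π k l = 0 < l × l ≤ k × π (l ∸ 1) ≡ π k
               × ((m : ℕ) → l ≤ m → π (m + (suc k ∸ l)) ≡ π m)

  SatNL : Path → ℕ → ℕ → LTL AP → Set
  SatNL π k i (pos p) = p ∈L π i
  SatNL π k i (neg p) = p ∉L π i
  SatNL π k i (a ∧ₗ b) = SatNL π k i a × SatNL π k i b
  SatNL π k i (a ∨ₗ b) = SatNL π k i a ⊎ SatNL π k i b
  SatNL π k i (Xₗ a) = i < k × SatNL π k (suc i) a
  SatNL π k i (a Uₗ b) = Σ ℕ λ j → i ≤ j × j ≤ k × SatNL π k j b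
                            × ((m : ℕ) → i ≤ m → m < j → SatNL π k m a)
  SatNL π k i (a Rₗ b) = Σ ℕ λ j → i ≤ j × j ≤ k × SatNL π k j a
                            × ((m : ℕ) → i ≤ m → m ≤ j → SatNL π k m b)

  _⊨[_]_ : Path → ℕ → LTL AP → Set
  π ⊨[ k ] ψ = (Σ ℕ λ l → IsLoop π k l × (π ⊨ ψ)) ⊎ SatNL π k 0 ψ

  data Var : Set where
    st         : ℕ → Fin n → Var
    lv         : ℕ → Var
    inLoop     : ℕ → Var
    loopExists : Var
    fv         : LTL AP → ℕ → Var
    acc        : LTL AP → ℕ → Var

  private
    v : Var → Prop Var
    v = varᵖ

  at : ℕ → Prop (Fin n) → Prop Var
  at i = rename (st i)

  modelC : ℕ → Prop Var
  modelC k = at 0 init ∧ᵖ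
    ⋀ (map (λ j → rename [ st j , st (suc j) ] trans) (upTo k))

  eqState : ℕ → ℕ → Prop Var
  eqState i k = ⋀ (map (λ x → v (st i x) ⇔ᵖ v (st k x)) (Data.List.allFin n))
    where import Data.List

  -- loop constraints; index i = suc j ranges over 1..k
  loopC : ℕ → Prop Var
  loopC k = (v (lv 0) ⇔ᵖ ⊥ᵖ) ∧ᵖ (v (inLoop 0) ⇔ᵖ ⊥ᵖ)
    ∧ᵖ ⋀ (map (λ j →
             (v (lv (suc j)) ⇒ᵖ eqState j k)
          ∧ᵖ (v (inLoop (suc j)) ⇔ᵖ (v (inLoop j) ∨ᵖ v (lv (suc j))))
          ∧ᵖ (v (inLoop j) ⇒ᵖ ¬ᵖ v (lv (suc j)))) (upTo k))
    ∧ᵖ (v loopExists ⇔ᵖ v (inLoop k))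

  fC : LTL AP → ℕ → Prop Var
  fC (pos p) i = v (fv (pos p) i) ⇔ᵖ at i (label p)
  fC (neg p) i = v (fv (neg p) i) ⇔ᵖ ¬ᵖ at i (label p)
  fC (a ∧ₗ b) i = v (fv (a ∧ₗ b) i) ⇔ᵖ (v (fv a i) ∧ᵖ v (fv b i))
  fC (a ∨ₗ b) i = v (fv (a ∨ₗ b) i) ⇔ᵖ (v (fv a i) ∨ᵖ v (fv b i))
  fC (Xₗ a) i = v (fv (Xₗ a) i) ⇔ᵖ v (fv a (suc i))
  fC (a Uₗ b) i = v (fv (a Uₗ b) i) ⇔ᵖ
    (v (fv b i) ∨ᵖ (v (fv a i) ∧ᵖ v (fv (a Uₗ b) (suc i))))
  fC (a Rₗ b) i = v (fv (a Rₗ b) i) ⇔ᵖ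
    (v (fv b i) ∧ᵖ (v (fv a i) ∨ᵖ v (fv (a Rₗ b) (suc i))))

  formulaC : LTL AP → ℕ → Prop Var
  formulaC ψ k = ⋀ (map (λ φ → ⋀ (map (fC φ) (upTo (suc k)))) (cl ψ))

  lastC : LTL AP → ℕ → Prop Var
  lastC ψ k = ⋀ (map (λ φ →
       (¬ᵖ v loopExists ⇒ᵖ (v (fv φ (suc k)) ⇔ᵖ ⊥ᵖ))
    ∧ᵖ ⋀ (map (λ j → v (lv (suc j)) ⇒ᵖ (v (fv φ (suc k)) ⇔ᵖ v (fv φ (suc j))))
              (upTo k))) (cl ψ))

  accC : LTL AP → ℕ → Prop Var
  accC (a Uₗ b) k = (v (acc φ 0) ⇔ᵖ ⊥ᵖ) ∧ᵖ (v loopExists ⇒ᵖ v (acc φ k))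
    ∧ᵖ ⋀ (map (λ j → v (acc φ (suc j)) ⇔ᵖ (v (acc φ j) ∨ᵖ
            (v (inLoop (suc j)) ∧ᵖ (v (fv b (suc j)) ∨ᵖ ¬ᵖ v (fv φ (suc j))))))
          (upTo k))
    where φ = a Uₗ b
  accC (a Rₗ b) k = (v (acc φ 0) ⇔ᵖ ⊥ᵖ) ∧ᵖ (v loopExists ⇒ᵖ v (acc φ k))
    ∧ᵖ ⋀ (map (λ j → v (acc φ (suc j)) ⇔ᵖ (v (acc φ j) ∨ᵖ
            (v (inLoop (suc j)) ∧ᵖ (¬ᵖ v (fv b (suc j)) ∨ᵖ v (fv φ (suc j))))))
          (upTo k))
    where φ = a Rₗ b
  accC _ k = ⊤ᵖ

  acceptC : LTL AP → ℕ → Prop Var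
  acceptC ψ k = ⋀ (map (λ φ → accC φ k) (cl ψ))

  encode : LTL AP → ℕ → Prop Var
  encode ψ k = modelC k ∧ᵖ loopC k ∧ᵖ lastC ψ k ∧ᵖ formulaC ψ k
            ∧ᵖ acceptC ψ k ∧ᵖ v (fv ψ 0)

-- A satisfying assignment σ yields states s₀ … s_k and labels [[φ]]_i that obey the
-- unfolding laws of LTL. If LoopExists holds, the loop constraints single out the loop start l and
-- the acceptance constraints put a fulfilment of every until-subformula inside s_l … s_k, so the
-- labelled lasso s₀ … s_{l-1} (s_l … s_k)^ω is a Hintikka structure and satisfies ψ. Otherwise all
-- labels at k+1 are false, no until can be postponed past k, and any infinite continuation works.
--
-- On a (k,l)-loop satisfaction is decidable (witnesses can be pulled back by one
-- period), and on a bounded prefix it is decidable anyway; setting [[φ]]_i to the truth of φ at i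
-- satisfies the encoding. An arbitrary initialised path satisfying ψ is first replaced by a lasso:
-- classically there are positions a < b of the same type (state and truth values on cl ψ) with
-- every until-subformula fulfilled in [a, b). The lasso walks through the finitely many types, and
-- shortening its walks bounds its size, so a short lasso can be found by exhaustive search; this
-- makes the existence statement decidable and removes the double negation.

{-# OPTIONS --safe #-}
module Submission where

open import Defs
open import Data.Nat using (ℕ)
open import Data.Product using (Σ; _×_)
open import Function.Bundles using (_⇔_)

open import Data.Bool using (Bool; true; false; not; _∧_; _∨_)
import Data.Bool as Bool
open import Data.Fin using (Fin; toℕ; combine)
import Data.Fin as Fin
open import Data.Fin.Properties using (pigeonhole; toℕ≤pred[n]; combine-injective)
open import Data.Fin.Subset.Properties using (anySubset?)
open import Data.List using ([]; _∷_; _++_; map; upTo; allFin; length)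
open import Data.List.Membership.Propositional using (_∈_)
open import Data.List.Membership.Propositional.Properties using (∈-++⁺ˡ; ∈-++⁺ʳ; ∈-++⁻; ∈-upTo⁺; ∈-upTo⁻; ∈-allFin)
open import Data.List.Relation.Unary.All using (All; []; _∷_)
import Data.List.Relation.Unary.All as All
open import Data.List.Relation.Unary.Any using (here; there; index)
open import Data.Nat using (zero; suc; _+_; _∸_; _*_; _^_; _⊔_; _≤_; _<_; z≤n; s≤s; z<s; s<s; s≤s⁻¹; s<s⁻¹; _<?_; _≤?_; _≟_; NonZero; >-nonZero)
open import Data.Nat.DivMod using (_%_; _/_; m<n⇒m%n≡m; [m+n]%n≡m%n; m%n<n; n%n≡0; m≡m%n+[m/n]*n; [m+kn]%n≡m%n)
open import Data.Nat.Induction using (<-rec)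
open import Data.Nat.Properties
open import Data.Product using (_,_; proj₁; proj₂; ∃; ∃₂)
open import Data.Product.Function.NonDependent.Propositional using (_×-⇔_)
open import Data.Sum using (_⊎_; inj₁; inj₂; [_,_]; [_,_]′)
import Data.Sum as ⊎
open import Data.Sum.Function.Propositional using (_⊎-⇔_)
open import Data.Unit using (⊤; tt)
open import Data.Vec using (Vec; []; _∷_; lookup; tabulate; replicate)
import Data.Vec as Vec
open import Data.Vec.Properties using (lookup∘tabulate; tabulate∘lookup; tabulate-cong; ≡-dec)
open import Data.Vec.Relation.Unary.Linked using (Linked; [-]; _∷_)
import Data.Vec.Relation.Unary.Linked.Properties as Linked
open import Effect.Monad using (RawMonad)
open import Function using (_∘_; id; flip; case_of_)
open import Function.Bundles using (mk⇔; module Equivalence)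
open import Function.Construct.Composition using (_⇔-∘_)
open import Function.Construct.Identity using (⇔-id)
open import Function.Construct.Symmetry using (⇔-sym)
open import Level using (0ℓ)
open import Relation.Binary.Construct.Closure.ReflexiveTransitive using (Star; ε; _◅_; _◅◅_)
open import Relation.Binary.PropositionalEquality hiding ([_])
open import Relation.Nullary using (¬_; Dec; yes; no; does; contradiction)
open import Relation.Nullary.Decidable using (map′; _×-dec_; _⊎-dec_; _→-dec_; dec-true; dec-false; does-⇔; decidable-stable)
open import Relation.Nullary.Decidable.Core using (¬¬-excluded-middle)
open import Relation.Nullary.Negation using (¬¬-Monad)

open Equivalence using (to; from)

infix 3.5 _⊨ᵖ_

-- A record rather than eval σ φ ≡ true, so that unification can read φ off the type.
record _⊨ᵖ_ {V : Set} (σ : V → Bool) (φ : Prop V) : Set where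
  constructor holds
  field evaluates-true : eval σ φ ≡ true
open _⊨ᵖ_

∧-true : ∀ x {y} → x ∧ y ≡ true ⇔ (x ≡ true × y ≡ true)
∧-true true = mk⇔ (refl ,_) proj₂
∧-true false = mk⇔ (λ ()) (λ ())

∨-true : ∀ x {y} → x ∨ y ≡ true ⇔ (x ≡ true ⊎ y ≡ true)
∨-true true = mk⇔ inj₁ (λ _ → refl)
∨-true false = mk⇔ inj₂ [ (λ ()) , id ]′

⇒-true : ∀ x {y} → not x ∨ y ≡ true ⇔ (x ≡ true → y ≡ true)
⇒-true true = mk⇔ (λ y _ → y) (λ f → f refl)
⇒-true false = mk⇔ (λ _ ()) (λ _ → refl)

⇔ᵇ-true : ∀ x y → x ⇔ᵇ y ≡ true ⇔ (x ≡ y)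
⇔ᵇ-true true true = mk⇔ (λ _ → refl) (λ _ → refl)
⇔ᵇ-true true false = mk⇔ (λ ()) (λ ())
⇔ᵇ-true false true = mk⇔ (λ ()) (λ ())
⇔ᵇ-true false false = mk⇔ (λ _ → refl) (λ _ → refl)

not-true : ∀ x → not x ≡ true ⇔ (x ≡ false)
not-true true = mk⇔ (λ ()) (λ ())
not-true false = mk⇔ (λ _ → refl) (λ _ → refl)

true-ext : ∀ {x y} → (x ≡ true ⇔ y ≡ true) → x ≡ y
true-ext {true} x⇔y = sym (to x⇔y refl)
true-ext {false} {true} x⇔y = from x⇔y refl
true-ext {false} {false} _ = refl

does-true : ∀ {P : Set} (d : Dec P) → does d ≡ true ⇔ P
does-true (yes p) = mk⇔ (λ _ → p) (λ _ → refl)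
does-true (no ¬p) = mk⇔ (λ ()) (λ p → contradiction p ¬p)

module _ {V : Set} {σ : V → Bool} where

  var-holds : ∀ {x} → σ ⊨ᵖ varᵖ x ⇔ σ x ≡ true
  var-holds = mk⇔ evaluates-true holds

  ¬ᵖ-holds : ∀ {a} → σ ⊨ᵖ ¬ᵖ a ⇔ (eval σ a ≡ false)
  ¬ᵖ-holds {a} = mk⇔ (λ (holds e) → to (not-true (eval σ a)) e) (λ e → holds (from (not-true (eval σ a)) e))

  ∧ᵖ-holds : ∀ {a b} → σ ⊨ᵖ a ∧ᵖ b ⇔ (σ ⊨ᵖ a × σ ⊨ᵖ b)
  ∧ᵖ-holds {a} = mk⇔ (λ (holds e) → let ea , eb = to (∧-true (eval σ a)) e in holds ea , holds eb)
                     (λ (holds ea , holds eb) → holds (from (∧-true (eval σ a)) (ea , eb)))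

  ∨ᵖ-holds : ∀ {a b} → σ ⊨ᵖ a ∨ᵖ b ⇔ (σ ⊨ᵖ a ⊎ σ ⊨ᵖ b)
  ∨ᵖ-holds {a} = mk⇔ (λ (holds e) → ⊎.map holds holds (to (∨-true (eval σ a)) e))
                     (λ h → holds (from (∨-true (eval σ a)) (⊎.map evaluates-true evaluates-true h)))

  ⇒ᵖ-holds : ∀ {a b} → σ ⊨ᵖ a ⇒ᵖ b ⇔ (σ ⊨ᵖ a → σ ⊨ᵖ b)
  ⇒ᵖ-holds {a} = mk⇔ (λ (holds e) (holds ea) → holds (to (⇒-true (eval σ a)) e ea))
                     (λ f → holds (from (⇒-true (eval σ a)) (evaluates-true ∘ f ∘ holds)))

  ⇔ᵖ-holds : ∀ {a b} → σ ⊨ᵖ a ⇔ᵖ b ⇔ (eval σ a ≡ eval σ b)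
  ⇔ᵖ-holds {a} {b} = mk⇔ (λ (holds e) → to (⇔ᵇ-true (eval σ a) (eval σ b)) e)
                         (λ e → holds (from (⇔ᵇ-true (eval σ a) (eval σ b)) e))

  ⇔ᵖ-iff : ∀ {a b} → σ ⊨ᵖ a ⇔ᵖ b ⇔ (σ ⊨ᵖ a ⇔ σ ⊨ᵖ b)
  ⇔ᵖ-iff = mk⇔ (λ h → let e = to ⇔ᵖ-holds h in
                       mk⇔ (λ (holds ea) → holds (trans (sym e) ea)) (λ (holds eb) → holds (trans e eb)))
               (λ a⇔b → from ⇔ᵖ-holds (true-ext (mk⇔ (evaluates-true ∘ to a⇔b ∘ holds) (evaluates-true ∘ from a⇔b ∘ holds))))

module _ {V A : Set} {σ : V → Bool} (f : A → Prop V) where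

  ⋀⁺ : ∀ xs → (∀ {x} → x ∈ xs → σ ⊨ᵖ f x) → σ ⊨ᵖ ⋀ (map f xs)
  ⋀⁺ [] h = holds refl
  ⋀⁺ (x ∷ xs) h = from ∧ᵖ-holds (h (here refl) , ⋀⁺ xs (h ∘ there))

  ⋀⁻ : ∀ {xs x} → σ ⊨ᵖ ⋀ (map f xs) → x ∈ xs → σ ⊨ᵖ f x
  ⋀⁻ h (here refl) = proj₁ (to ∧ᵖ-holds h)
  ⋀⁻ h (there x∈xs) = ⋀⁻ (proj₂ (to ∧ᵖ-holds h)) x∈xs

module _ {V : Set} where

  eval-cong : ∀ {σ σ′ : V → Bool} → (∀ x → σ x ≡ σ′ x) → ∀ φ → eval σ φ ≡ eval σ′ φ
  eval-cong h ⊤ᵖ = refl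
  eval-cong h ⊥ᵖ = refl
  eval-cong h (varᵖ x) = h x
  eval-cong h (¬ᵖ a) = cong not (eval-cong h a)
  eval-cong h (a ∧ᵖ b) = cong₂ _∧_ (eval-cong h a) (eval-cong h b)
  eval-cong h (a ∨ᵖ b) = cong₂ _∨_ (eval-cong h a) (eval-cong h b)
  eval-cong h (a ⇒ᵖ b) = cong₂ (λ x y → not x ∨ y) (eval-cong h a) (eval-cong h b)
  eval-cong h (a ⇔ᵖ b) = cong₂ _⇔ᵇ_ (eval-cong h a) (eval-cong h b)

  eval-rename : ∀ {W : Set} (σ : W → Bool) (f : V → W) φ → eval σ (rename f φ) ≡ eval (σ ∘ f) φ
  eval-rename σ f ⊤ᵖ = refl
  eval-rename σ f ⊥ᵖ = refl
  eval-rename σ f (varᵖ x) = refl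
  eval-rename σ f (¬ᵖ a) = cong not (eval-rename σ f a)
  eval-rename σ f (a ∧ᵖ b) = cong₂ _∧_ (eval-rename σ f a) (eval-rename σ f b)
  eval-rename σ f (a ∨ᵖ b) = cong₂ _∨_ (eval-rename σ f a) (eval-rename σ f b)
  eval-rename σ f (a ⇒ᵖ b) = cong₂ (λ x y → not x ∨ y) (eval-rename σ f a) (eval-rename σ f b)
  eval-rename σ f (a ⇔ᵖ b) = cong₂ _⇔ᵇ_ (eval-rename σ f a) (eval-rename σ f b)

module _ {P : ℕ → Set} {c d : ℕ} (0<d : 0 < d) (d≤c : d ≤ c) where

  private
    shrinks : ∀ {j} → c ≤ j → j ∸ d < j
    shrinks c≤j = ∸-monoʳ-< 0<d (≤-trans d≤c c≤j)

  witness-below : (∀ {j} → c ≤ j → P j → P (j ∸ d)) → ∀ {j} → P j → ∃ λ j′ → j′ < c × P j′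
  witness-below down {j} = <-rec (λ j → P j → ∃ λ j′ → j′ < c × P j′) step j
    where
    step : ∀ j → (∀ {i} → i < j → P i → ∃ λ j′ → j′ < c × P j′) → P j → ∃ λ j′ → j′ < c × P j′
    step j rec pj with j <? c
    ... | yes j<c = j , j<c , pj
    ... | no j≮c = rec (shrinks (≮⇒≥ j≮c)) (down (≮⇒≥ j≮c) pj)

  below⇒everywhere : (∀ {j} → c ≤ j → P (j ∸ d) → P j) → (∀ {j} → j < c → P j) → ∀ j → P j
  below⇒everywhere up below = <-rec P step
    where
    step : ∀ j → (∀ {i} → i < j → P i) → P j
    step j rec with j <? c
    ... | yes j<c = below j<c
    ... | no j≮c = up (≮⇒≥ j≮c) (rec (shrinks (≮⇒≥ j≮c)))


module _ {P : ℕ → Set} (P? : ∀ m → Dec (P m)) where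

  all-between? : ∀ i j → Dec (∀ m → i ≤ m → m < j → P m)
  all-between? i j = map′ (λ (f : ∀ {m} → m < j → i ≤ m → P m) m i≤m m<j → f m<j i≤m) (λ f m<j i≤m → f _ i≤m m<j)
                          (allUpTo? (λ m → (i ≤? m) →-dec P? m) j)

  any-between? : ∀ i j → Dec (∃ λ m → i ≤ m × m < j × P m)
  any-between? i j = map′ (λ (m , m<j , i≤m , pm) → m , i≤m , m<j , pm) (λ (m , i≤m , m<j , pm) → m , m<j , i≤m , pm)
                          (anyUpTo? (λ m → (i ≤? m) ×-dec P? m) j)

Searchable : Set → Set₁
Searchable A = ∀ {P : A → Set} → (∀ x → Dec (P x)) → Dec (∃ P)

Vec-searchable : ∀ {A} → Searchable A → ∀ m → Searchable (Vec A m)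
Vec-searchable search zero P? = map′ ([] ,_) (λ { ([] , p) → p }) (P? [])
Vec-searchable search (suc m) P? =
  map′ (λ (x , xs , p) → x ∷ xs , p) (λ { (x ∷ xs , p) → x , xs , p })
       (search λ x → Vec-searchable search m (λ xs → P? (x ∷ xs)))

infixl 5 _‼_

-- Lookup by a natural number; indices beyond the end return the last entry.
_‼_ : ∀ {A : Set} {k} → Vec A (suc k) → ℕ → A
(x ∷ []) ‼ _ = x
(x ∷ _ ∷ _) ‼ zero = x
(_ ∷ x ∷ xs) ‼ suc i = (x ∷ xs) ‼ i

‼-tabulate : ∀ {A : Set} k (f : ℕ → A) {i} → i ≤ k → tabulate {suc k} (f ∘ toℕ) ‼ i ≡ f i
‼-tabulate zero f z≤n = refl
‼-tabulate (suc k) f {zero} _ = refl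
‼-tabulate (suc k) f {suc i} 1+i≤1+k = ‼-tabulate k (f ∘ suc) (s≤s⁻¹ 1+i≤1+k)

bit : Bool → Fin 2
bit false = Fin.zero
bit true = Fin.suc Fin.zero

bit-injective : ∀ {x y} → bit x ≡ bit y → x ≡ y
bit-injective {false} {false} _ = refl
bit-injective {true} {true} _ = refl

encodeBits : ∀ {m} → Vec Bool m → Fin (2 ^ m)
encodeBits [] = Fin.zero
encodeBits (x ∷ xs) = combine (bit x) (encodeBits xs)

encodeBits-injective : ∀ {m} {xs ys : Vec Bool m} → encodeBits xs ≡ encodeBits ys → xs ≡ ys
encodeBits-injective {xs = []} {[]} _ = refl
encodeBits-injective {xs = x ∷ xs} {y ∷ ys} e =
  let x≡y , xs≡ys = combine-injective (bit x) (encodeBits xs) (bit y) (encodeBits ys) e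
  in cong₂ _∷_ (bit-injective x≡y) (encodeBits-injective xs≡ys)

module Walks {A : Set} {E : A → A → Set} where

  len : ∀ {x y} → Star E x y → ℕ
  len ε = 0
  len (_ ◅ w) = suc (len w)

  vertex : ∀ {x y} → Star E x y → ℕ → A
  vertex {x} ε _ = x
  vertex {x} (_ ◅ w) zero = x
  vertex (_ ◅ w) (suc i) = vertex w i

  vertex-0 : ∀ {x y} (w : Star E x y) → vertex w 0 ≡ x
  vertex-0 ε = refl
  vertex-0 (_ ◅ w) = refl

  vertex-len : ∀ {x y} (w : Star E x y) → vertex w (len w) ≡ y
  vertex-len ε = refl
  vertex-len (_ ◅ w) = vertex-len w

  vertex-edge : ∀ {x y} (w : Star E x y) {i} → i < len w → E (vertex w i) (vertex w (suc i))
  vertex-edge (e ◅ w) {zero} _ = subst (E _) (sym (vertex-0 w)) e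
  vertex-edge (_ ◅ w) {suc i} 1+i<len = vertex-edge w (s<s⁻¹ 1+i<len)

  len-◅◅ : ∀ {x y z} (w : Star E x y) (v : Star E y z) → len (w ◅◅ v) ≡ len w + len v
  len-◅◅ ε v = refl
  len-◅◅ (_ ◅ w) v = cong suc (len-◅◅ w v)

  len-◅◅-≤ : ∀ {x y z} {w : Star E x y} {v : Star E y z} {m m′} → len w ≤ m → len v ≤ m′ → len (w ◅◅ v) ≤ m + m′
  len-◅◅-≤ {w = w} {v} w≤m v≤m′ = ≤-trans (≤-reflexive (len-◅◅ w v)) (+-mono-≤ w≤m v≤m′)

  vertex-◅◅ˡ : ∀ {x y z} (w : Star E x y) (v : Star E y z) {i} → i ≤ len w → vertex (w ◅◅ v) i ≡ vertex w i
  vertex-◅◅ˡ ε v z≤n = vertex-0 v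
  vertex-◅◅ˡ (_ ◅ w) v {zero} _ = refl
  vertex-◅◅ˡ (_ ◅ w) v {suc i} 1+i≤ = vertex-◅◅ˡ w v (s≤s⁻¹ 1+i≤)

  vertex-◅◅ʳ : ∀ {x y z} (w : Star E x y) (v : Star E y z) i → vertex (w ◅◅ v) (len w + i) ≡ vertex v i
  vertex-◅◅ʳ ε v i = refl
  vertex-◅◅ʳ (_ ◅ w) v i = vertex-◅◅ʳ w v i

  Visits : ∀ {x y} → Star E x y → A → Set
  Visits w z = ∃ λ i → i ≤ len w × vertex w i ≡ z

  visits-end : ∀ {x y} (w : Star E x y) → Visits w y
  visits-end w = len w , ≤-refl , vertex-len w

  visits-◅◅ˡ : ∀ {x y z t} {w : Star E x y} (v : Star E y z) → Visits w t → Visits (w ◅◅ v) t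
  visits-◅◅ˡ {w = w} v (i , i≤ , eq) =
    i , ≤-trans i≤ (≤-trans (m≤m+n (len w) (len v)) (≤-reflexive (sym (len-◅◅ w v)))) , trans (vertex-◅◅ˡ w v i≤) eq

  visits-◅◅ʳ : ∀ {x y z t} (w : Star E x y) {v : Star E y z} → Visits v t → Visits (w ◅◅ v) t
  visits-◅◅ʳ w {v} (i , i≤ , eq) =
    len w + i , ≤-trans (+-monoʳ-≤ (len w) i≤) (≤-reflexive (sym (len-◅◅ w v))) , trans (vertex-◅◅ʳ w v i) eq

  suffix : ∀ {x y} (w : Star E x y) i → Star E (vertex w i) y
  suffix ε _ = ε
  suffix (e ◅ w) zero = e ◅ w
  suffix (_ ◅ w) (suc i) = suffix w i

  len-suffix : ∀ {x y} (w : Star E x y) i → len (suffix w i) ≡ len w ∸ i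
  len-suffix ε zero = refl
  len-suffix ε (suc i) = refl
  len-suffix (_ ◅ w) zero = refl
  len-suffix (_ ◅ w) (suc i) = len-suffix w i

  len-subst : ∀ {x x′ y} (x≡x′ : x ≡ x′) (w : Star E x y) → len (subst (λ v → Star E v y) x≡x′ w) ≡ len w
  len-subst refl w = refl

  cut : ∀ {x y} (w : Star E x y) {i j} → i < j → j ≤ len w → vertex w i ≡ vertex w j → ∃ λ (w′ : Star E x y) → len w′ < len w
  cut w {zero} {j} 0<j j≤len w₀≡wⱼ =
      subst (λ v → Star E v _) (trans (sym w₀≡wⱼ) (vertex-0 w)) (suffix w j)
    , subst (_< len w) (sym (trans (len-subst _ (suffix w j)) (len-suffix w j))) (∸-monoʳ-< 0<j j≤len)
  cut (e ◅ w) {suc i} {suc j} i<j j≤len wᵢ≡wⱼ =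
    let w′ , shorter = cut w (s<s⁻¹ i<j) (s≤s⁻¹ j≤len) wᵢ≡wⱼ in e ◅ w′ , s<s shorter

  module _ {N : ℕ} (code : A → Fin N) (code-injective : ∀ {x y} → code x ≡ code y → x ≡ y) where

    Short : A → A → Set
    Short x y = ∃ λ (w : Star E x y) → len w < N

    shorten : ∀ {x y} → Star E x y → Short x y
    shorten w = <-rec (λ m → ∀ {x y} (w : Star E x y) → len w ≤ m → Short x y) step (len w) w ≤-refl
      where
      step : ∀ m → (∀ {m′} → m′ < m → ∀ {x y} (w : Star E x y) → len w ≤ m′ → Short x y) →
             ∀ {x y} (w : Star E x y) → len w ≤ m → Short x y
      step m rec w len≤m with len w <? N
      ... | yes short = w , short
      ... | no long =
        let i , j , i<j , same = pigeonhole (n<1+n N) (code ∘ vertex w ∘ toℕ)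
            w′ , shorter = cut w i<j (≤-trans (toℕ≤pred[n] j) (≮⇒≥ long)) (code-injective same)
        in rec (<-≤-trans shorter len≤m) w′ ≤-refl

module _ {AP : Set} where

  cl-self : ∀ φ → φ ∈ cl {AP} φ
  cl-self (pos p) = here refl
  cl-self (neg p) = here refl
  cl-self (a ∧ₗ b) = here refl
  cl-self (a ∨ₗ b) = here refl
  cl-self (Xₗ a) = here refl
  cl-self (a Uₗ b) = here refl
  cl-self (a Rₗ b) = here refl

  ∈-clˡ : ∀ {x c : LTL AP} {a b} → x ∈ cl a → x ∈ c ∷ cl a ++ cl b
  ∈-clˡ = there ∘ ∈-++⁺ˡ

  ∈-clʳ : ∀ {x c : LTL AP} a {b} → x ∈ cl b → x ∈ c ∷ cl a ++ cl b
  ∈-clʳ a = there ∘ ∈-++⁺ʳ (cl a)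

  cl-trans : ∀ {x φ} ψ → x ∈ cl {AP} φ → φ ∈ cl ψ → x ∈ cl ψ
  cl-trans-++ : ∀ {x φ} a b → x ∈ cl {AP} φ → φ ∈ cl a ++ cl b → x ∈ cl a ++ cl b

  cl-trans (pos p) x∈φ (here refl) = x∈φ
  cl-trans (neg p) x∈φ (here refl) = x∈φ
  cl-trans (Xₗ a) x∈φ (here refl) = x∈φ
  cl-trans (Xₗ a) x∈φ (there φ∈) = there (cl-trans a x∈φ φ∈)
  cl-trans (a ∧ₗ b) x∈φ (here refl) = x∈φ
  cl-trans (a ∧ₗ b) x∈φ (there φ∈) = there (cl-trans-++ a b x∈φ φ∈)
  cl-trans (a ∨ₗ b) x∈φ (here refl) = x∈φ
  cl-trans (a ∨ₗ b) x∈φ (there φ∈) = there (cl-trans-++ a b x∈φ φ∈)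
  cl-trans (a Uₗ b) x∈φ (here refl) = x∈φ
  cl-trans (a Uₗ b) x∈φ (there φ∈) = there (cl-trans-++ a b x∈φ φ∈)
  cl-trans (a Rₗ b) x∈φ (here refl) = x∈φ
  cl-trans (a Rₗ b) x∈φ (there φ∈) = there (cl-trans-++ a b x∈φ φ∈)

  cl-trans-++ a b x∈φ φ∈ with ∈-++⁻ (cl a) φ∈
  ... | inj₁ φ∈a = ∈-++⁺ˡ (cl-trans a x∈φ φ∈a)
  ... | inj₂ φ∈b = ∈-++⁺ʳ (cl a) (cl-trans b x∈φ φ∈b)

module _ {AP : Set} (M : Kripke AP) where
  open Kripke M using (n; _∈L_; _∉L_)

  Labelling : Set₁
  Labelling = ℕ → LTL AP → Set

  -- The right-hand sides of the formula-variable constraints [[φ]]_i ⇔ … of the encoding.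
  Expand : Labelling → (ℕ → State n) → ℕ → LTL AP → Set
  Expand L s i (pos p) = p ∈L s i
  Expand L s i (neg p) = p ∉L s i
  Expand L s i (a ∧ₗ b) = L i a × L i b
  Expand L s i (a ∨ₗ b) = L i a ⊎ L i b
  Expand L s i (Xₗ a) = L (suc i) a
  Expand L s i (a Uₗ b) = L i b ⊎ (L i a × L (suc i) (a Uₗ b))
  Expand L s i (a Rₗ b) = L i b × (L i a ⊎ L (suc i) (a Rₗ b))

  Expand-map : ∀ φ {L L′ : Labelling} {s s′ i i′} → s i ≡ s′ i′ →
               (∀ {x} → L i x → L′ i′ x) →
               (∀ {x} → x ∈ cl φ → L (suc i) x → L′ (suc i′) x) →
               Expand L s i φ → Expand L′ s′ i′ φ
  Expand-map (pos p) s≡ now next e = subst (p ∈L_) s≡ e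
  Expand-map (neg p) s≡ now next e = subst (p ∉L_) s≡ e
  Expand-map (a ∧ₗ b) s≡ now next (ea , eb) = now ea , now eb
  Expand-map (a ∨ₗ b) s≡ now next (inj₁ ea) = inj₁ (now ea)
  Expand-map (a ∨ₗ b) s≡ now next (inj₂ eb) = inj₂ (now eb)
  Expand-map (Xₗ a) s≡ now next e = next (there (cl-self a)) e
  Expand-map (a Uₗ b) s≡ now next (inj₁ eb) = inj₁ (now eb)
  Expand-map (a Uₗ b) s≡ now next (inj₂ (ea , e′)) = inj₂ (now ea , next (here refl) e′)
  Expand-map (a Rₗ b) s≡ now next (eb , inj₁ ea) = now eb , inj₁ (now ea)
  Expand-map (a Rₗ b) s≡ now next (eb , inj₂ e′) = now eb , inj₂ (next (here refl) e′)

  module _ {π : Path M} {i : ℕ} {a b : LTL AP} where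

    Until-offset : Sat M π i (a Uₗ b) ⇔ ∃ λ e → Sat M π (i + e) b × (∀ {f} → f < e → Sat M π (i + f) a)
    Until-offset = mk⇔ forward backward
      where
      forward : Sat M π i (a Uₗ b) → ∃ λ e → Sat M π (i + e) b × (∀ {f} → f < e → Sat M π (i + f) a)
      forward (j , i≤j , sb , sa) with m≤n⇒∃[o]m+o≡n i≤j
      ... | e , refl = e , sb , λ {f} f<e → sa (i + f) (m≤m+n i f) (+-monoʳ-< i f<e)
      backward : (∃ λ e → Sat M π (i + e) b × (∀ {f} → f < e → Sat M π (i + f) a)) → Sat M π i (a Uₗ b)
      backward (e , sb , sa) = i + e , m≤m+n i e , sb , before
        where
        before : ∀ m → i ≤ m → m < i + e → Sat M π m a
        before m i≤m m<i+e with m≤n⇒∃[o]m+o≡n i≤m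
        ... | f , refl = sa (+-cancelˡ-< i f e m<i+e)

    Release-offset : Sat M π i (a Rₗ b) ⇔ (∀ e → Sat M π (i + e) b ⊎ ∃ λ f → f < e × Sat M π (i + f) a)
    Release-offset = mk⇔ forward backward
      where
      forward : Sat M π i (a Rₗ b) → ∀ e → Sat M π (i + e) b ⊎ ∃ λ f → f < e × Sat M π (i + f) a
      forward s e with s (i + e) (m≤m+n i e)
      ... | inj₁ sb = inj₁ sb
      ... | inj₂ (m , i≤m , m<i+e , sa) with m≤n⇒∃[o]m+o≡n i≤m
      ...   | f , refl = inj₂ (f , +-cancelˡ-< i f e m<i+e , sa)
      backward : (∀ e → Sat M π (i + e) b ⊎ ∃ λ f → f < e × Sat M π (i + f) a) → Sat M π i (a Rₗ b)
      backward h j i≤j with m≤n⇒∃[o]m+o≡n i≤j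
      ... | e , refl with h e
      ...   | inj₁ sb = inj₁ sb
      ...   | inj₂ (f , f<e , sa) = inj₂ (i + f , m≤m+n i f , +-monoʳ-< i f<e , sa)


  record Agree (π : Path M) (i : ℕ) (π′ : Path M) (i′ : ℕ) : Set where
    constructor agree
    field agrees : ∀ d → π (i + d) ≡ π′ (i′ + d)

  Agree-here : ∀ {π π′ i i′} → Agree π i π′ i′ → π i ≡ π′ i′
  Agree-here {π} {π′} {i} {i′} (agree h) = subst₂ (λ x y → π x ≡ π′ y) (+-identityʳ i) (+-identityʳ i′) (h 0)

  Agree-later : ∀ {π π′ i i′} → Agree π i π′ i′ → ∀ e → Agree π (i + e) π′ (i′ + e)
  Agree-later {π} {π′} {i} {i′} (agree h) e =
    agree λ d → subst₂ (λ x y → π x ≡ π′ y) (sym (+-assoc i e d)) (sym (+-assoc i′ e d)) (h (e + d))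

  Agree-next : ∀ {π π′ i i′} → Agree π i π′ i′ → Agree π (suc i) π′ (suc i′)
  Agree-next {π} {π′} {i} {i′} (agree h) =
    agree λ d → subst₂ (λ x y → π x ≡ π′ y) (+-suc i d) (+-suc i′ d) (h (suc d))

  Agree-sym : ∀ {π π′ i i′} → Agree π i π′ i′ → Agree π′ i′ π i
  Agree-sym (agree h) = agree (sym ∘ h)

  Sat-shift : ∀ φ {π π′ i i′} → Agree π i π′ i′ → Sat M π i φ → Sat M π′ i′ φ
  Sat-shift (pos p) h s = subst (p ∈L_) (Agree-here h) s
  Sat-shift (neg p) h s = subst (p ∉L_) (Agree-here h) s
  Sat-shift (a ∧ₗ b) h (sa , sb) = Sat-shift a h sa , Sat-shift b h sb
  Sat-shift (a ∨ₗ b) h s = ⊎.map (Sat-shift a h) (Sat-shift b h) s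
  Sat-shift (Xₗ a) h s = Sat-shift a (Agree-next h) s
  Sat-shift (a Uₗ b) {π} {π′} {i} {i′} h s =
    let e , sb , sa = to (Until-offset {π} {i} {a} {b}) s
    in from (Until-offset {π′} {i′} {a} {b}) (e , Sat-shift b (Agree-later h e) sb , Sat-shift a (Agree-later h _) ∘ sa)
  Sat-shift (a Rₗ b) {π} {π′} {i} {i′} h s = from (Release-offset {π′} {i′} {a} {b}) λ e →
    ⊎.map (Sat-shift b (Agree-later h e)) (λ (f , f<e , sa) → f , f<e , Sat-shift a (Agree-later h f) sa)
          (to (Release-offset {π} {i} {a} {b}) s e)

  module _ {π : Path M} {i : ℕ} where

    Expand⇒Sat : ∀ φ → Expand (Sat M π) π i φ → Sat M π i φ
    Expand⇒Sat (pos p) e = e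
    Expand⇒Sat (neg p) e = e
    Expand⇒Sat (a ∧ₗ b) e = e
    Expand⇒Sat (a ∨ₗ b) e = e
    Expand⇒Sat (Xₗ a) e = e
    Expand⇒Sat (a Uₗ b) (inj₁ sb) = i , ≤-refl , sb , λ m i≤m m<i → contradiction i≤m (<⇒≱ m<i)
    Expand⇒Sat (a Uₗ b) (inj₂ (sa , j , i<j , sb , sa′)) = j , <⇒≤ i<j , sb , before
      where
      before : ∀ m → i ≤ m → m < j → Sat M π m a
      before m i≤m m<j with m≤n⇒m<n∨m≡n i≤m
      ... | inj₁ i<m = sa′ m i<m m<j
      ... | inj₂ refl = sa
    Expand⇒Sat (a Rₗ b) (sb , later) j i≤j with m≤n⇒m<n∨m≡n i≤j
    ... | inj₂ refl = inj₁ sb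
    ... | inj₁ i<j with later
    ...   | inj₁ sa = inj₂ (i , ≤-refl , i<j , sa)
    ...   | inj₂ s′ = ⊎.map id (λ (m , i<m , m<j , sa) → m , <⇒≤ i<m , m<j , sa) (s′ j i<j)

    Sat⇒Expand : ∀ φ → (∀ {x} → x ∈ cl φ → Dec (Sat M π i x)) → Sat M π i φ → Expand (Sat M π) π i φ
    Sat⇒Expand (pos p) _ s = s
    Sat⇒Expand (neg p) _ s = s
    Sat⇒Expand (a ∧ₗ b) _ s = s
    Sat⇒Expand (a ∨ₗ b) _ s = s
    Sat⇒Expand (Xₗ a) _ s = s
    Sat⇒Expand (a Uₗ b) _ (j , i≤j , sb , sa) with m≤n⇒m<n∨m≡n i≤j
    ... | inj₂ refl = inj₁ sb
    ... | inj₁ i<j = inj₂ (sa i ≤-refl i<j , j , i<j , sb , λ m i<m → sa m (<⇒≤ i<m))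
    Sat⇒Expand (a Rₗ b) dec s = now , later (dec (∈-clˡ (cl-self a)))
      where
      now : Sat M π i b
      now with s i ≤-refl
      ... | inj₁ sb = sb
      ... | inj₂ (m , i≤m , m<i , _) = contradiction i≤m (<⇒≱ m<i)
      later : Dec (Sat M π i a) → Sat M π i a ⊎ Sat M π (suc i) (a Rₗ b)
      later (yes sa) = inj₁ sa
      later (no ¬sa) = inj₂ λ j i<j → ⊎.map id (step j) (s j (<⇒≤ i<j))
        where
        step : ∀ j → (∃ λ m → i ≤ m × m < j × Sat M π m a) → ∃ λ m → suc i ≤ m × m < j × Sat M π m a
        step j (m , i≤m , m<j , sa) with m≤n⇒m<n∨m≡n i≤m
        ... | inj₁ i<m = m , i<m , m<j , sa
        ... | inj₂ refl = contradiction sa ¬sa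

  Consistent : LTL AP → Path M → Labelling → Set
  Consistent ψ π L = ∀ {φ} → φ ∈ cl ψ → ∀ u → L u φ → Expand L π u φ

  Fair : LTL AP → Labelling → Set
  Fair ψ L = ∀ {a b} → a Uₗ b ∈ cl ψ → ∀ u → ∃ λ u′ → u ≤ u′ × (L u′ b ⊎ ¬ L u′ (a Uₗ b))

  module _ {ψ : LTL AP} {π : Path M} {L : Labelling} (consistent : Consistent ψ π L) where

    until-sound : ∀ {a b} → a Uₗ b ∈ cl ψ → Fair ψ L → (∀ {v} → L v a → Sat M π v a) → (∀ {v} → L v b → Sat M π v b) →
                  ∀ {u} → L u (a Uₗ b) → Sat M π u (a Uₗ b)
    until-sound {a} {b} U∈ fair sound-a sound-b {u} l =
      let u′ , u≤u′ , fulfilled = fair U∈ u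
          d , u+d≡u′ = m≤n⇒∃[o]m+o≡n u≤u′
      in reach fulfilled d u (trans (+-comm d u) u+d≡u′) l
      where
      reach : ∀ {u′} → L u′ b ⊎ ¬ L u′ (a Uₗ b) → ∀ d v → d + v ≡ u′ → L v (a Uₗ b) → Sat M π v (a Uₗ b)
      reach fulfilled d v eq l with consistent U∈ v l
      ... | inj₁ lb = Expand⇒Sat (a Uₗ b) (inj₁ (sound-b lb))
      reach (inj₁ lb) zero v refl l | inj₂ _ = Expand⇒Sat (a Uₗ b) (inj₁ (sound-b lb))
      reach (inj₂ ¬l) zero v refl l | inj₂ _ = contradiction l ¬l
      reach fulfilled (suc d) v eq l | inj₂ (la , l′) =
        Expand⇒Sat (a Uₗ b) (inj₂ (sound-a la , reach fulfilled d (suc v) (trans (+-suc d v) eq) l′))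

    release-sound : ∀ {a b} → a Rₗ b ∈ cl ψ → (∀ {v} → L v a → Sat M π v a) → (∀ {v} → L v b → Sat M π v b) →
                    ∀ {u} → L u (a Rₗ b) → Sat M π u (a Rₗ b)
    release-sound {a} {b} R∈ sound-a sound-b {u} l =
      from (Release-offset {π} {u} {a} {b}) λ e →
        ⊎.map (subst (λ w → Sat M π w b) (+-comm e u))
              (λ (f , f<e , sa) → f , f<e , subst (λ w → Sat M π w a) (+-comm f u) sa)
              (unroll e u l)
      where
      unroll : ∀ e v → L v (a Rₗ b) → Sat M π (e + v) b ⊎ ∃ λ f → f < e × Sat M π (f + v) a
      unroll e v l with consistent R∈ v l
      unroll zero v l | lb , _ = inj₁ (sound-b lb)
      unroll (suc e) v l | _ , inj₁ la = inj₂ (0 , z<s , sound-a la)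
      unroll (suc e) v l | _ , inj₂ l′ =
        ⊎.map (subst (λ w → Sat M π w b) (+-suc e v))
              (λ (f , f<e , sa) → suc f , s<s f<e , subst (λ w → Sat M π w a) (+-suc f v) sa)
              (unroll e (suc v) l′)

    hintikka-sound : Fair ψ L → ∀ {φ} → φ ∈ cl ψ → ∀ {u} → L u φ → Sat M π u φ
    hintikka-sound fair {φ} φ∈ = sound φ (λ x∈ → cl-trans ψ x∈ φ∈)
      where
      sound : ∀ φ → (∀ {x} → x ∈ cl φ → x ∈ cl ψ) → ∀ {u} → L u φ → Sat M π u φ
      sound (pos p) ⊆ψ l = consistent (⊆ψ (here refl)) _ l
      sound (neg p) ⊆ψ l = consistent (⊆ψ (here refl)) _ l
      sound (a ∧ₗ b) ⊆ψ l = Data.Product.map (sound a (⊆ψ ∘ ∈-clˡ)) (sound b (⊆ψ ∘ ∈-clʳ a)) (consistent (⊆ψ (here refl)) _ l)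
      sound (a ∨ₗ b) ⊆ψ l = ⊎.map (sound a (⊆ψ ∘ ∈-clˡ)) (sound b (⊆ψ ∘ ∈-clʳ a)) (consistent (⊆ψ (here refl)) _ l)
      sound (Xₗ a) ⊆ψ l = sound a (⊆ψ ∘ there) (consistent (⊆ψ (here refl)) _ l)
      sound (a Uₗ b) ⊆ψ l = until-sound (⊆ψ (here refl)) fair (sound a (⊆ψ ∘ ∈-clˡ)) (sound b (⊆ψ ∘ ∈-clʳ a)) l
      sound (a Rₗ b) ⊆ψ l = release-sound (⊆ψ (here refl)) (sound a (⊆ψ ∘ ∈-clˡ)) (sound b (⊆ψ ∘ ∈-clʳ a)) l

module Lasso {k l : ℕ} (0<l : 0 < l) (l≤k : l ≤ k) where

  period : ℕ
  period = suc k ∸ l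

  l+period≡1+k : l + period ≡ suc k
  l+period≡1+k = m+[n∸m]≡n (m≤n⇒m≤1+n l≤k)

  1+k∸period≡l : suc k ∸ period ≡ l
  1+k∸period≡l = m∸[m∸n]≡n (m≤n⇒m≤1+n l≤k)

  0<period : 0 < period
  0<period = m<n⇒0<n∸m (s≤s l≤k)

  instance
    period-nonZero : NonZero period
    period-nonZero = >-nonZero 0<period

  -- Position u of the lasso s₀ … s_{l-1} (s_l … s_k)^ω carries the state s (reduce u).
  reduce : ℕ → ℕ
  reduce u with u <? l
  ... | yes _ = u
  ... | no _ = l + (u ∸ l) % period

  reduce-< : ∀ {u} → u < l → reduce u ≡ u
  reduce-< {u} u<l with u <? l
  ... | yes _ = refl
  ... | no u≮l = contradiction u<l u≮l

  reduce-≥ : ∀ {u} → l ≤ u → reduce u ≡ l + (u ∸ l) % period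
  reduce-≥ {u} l≤u with u <? l
  ... | yes u<l = contradiction l≤u (<⇒≱ u<l)
  ... | no _ = refl

  reduce-id : ∀ {u} → u ≤ k → reduce u ≡ u
  reduce-id {u} u≤k = [ reduce-< , id-beyond ]′ (<-≤-connex u l)
    where
    open ≡-Reasoning
    id-beyond : l ≤ u → reduce u ≡ u
    id-beyond l≤u = begin
      reduce u              ≡⟨ reduce-≥ l≤u ⟩
      l + (u ∸ l) % period  ≡⟨ cong (l +_) (m<n⇒m%n≡m (∸-monoˡ-< (s≤s u≤k) l≤u)) ⟩
      l + (u ∸ l)           ≡⟨ m+[n∸m]≡n l≤u ⟩
      u                     ∎

  reduce-periodic : ∀ {m} → l ≤ m → reduce (m + period) ≡ reduce m
  reduce-periodic {m} l≤m = begin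
    reduce (m + period)              ≡⟨ reduce-≥ (≤-trans l≤m (m≤m+n m period)) ⟩
    l + (m + period ∸ l) % period    ≡⟨ cong (λ x → l + x % period) (+-∸-comm period l≤m) ⟩
    l + ((m ∸ l) + period) % period  ≡⟨ cong (l +_) ([m+n]%n≡m%n (m ∸ l) period) ⟩
    l + (m ∸ l) % period             ≡⟨ reduce-≥ l≤m ⟨
    reduce m                         ∎
    where open ≡-Reasoning

  private
    %-suc : ∀ x → suc x % period ≡ suc (x % period) % period
    %-suc x = begin
      suc x % period                                       ≡⟨ cong (λ y → suc y % period) (m≡m%n+[m/n]*n x period) ⟩
      (suc (x % period) + (x / period) * period) % period  ≡⟨ [m+kn]%n≡m%n (suc (x % period)) (x / period) period ⟩
      suc (x % period) % period                            ∎
      where open ≡-Reasoning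

  Successor : ℕ → ℕ → Set
  Successor i j = (i < k × j ≡ suc i) ⊎ (i ≡ k × j ≡ l)

  reduce-suc : ∀ u → Successor (reduce u) (reduce (suc u))
  reduce-suc u = [ before-loop , in-loop ]′ (<-≤-connex u l)
    where
    before-loop : u < l → Successor (reduce u) (reduce (suc u))
    before-loop u<l = inj₁ ( subst (_< k) (sym (reduce-< u<l)) (<-≤-trans u<l l≤k)
                           , trans (reduce-id (≤-trans u<l l≤k)) (cong suc (sym (reduce-< u<l))))
    in-loop : l ≤ u → Successor (reduce u) (reduce (suc u))
    in-loop l≤u = [ inj₁ ∘ advance , inj₂ ∘ wrap-around ]′ (m≤n⇒m<n∨m≡n (m%n<n (u ∸ l) period))
      where
      open ≡-Reasoning
      r : ℕ
      r = (u ∸ l) % period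
      reduce-1+u : reduce (suc u) ≡ l + suc r % period
      reduce-1+u = begin
        reduce (suc u)            ≡⟨ reduce-≥ (m≤n⇒m≤1+n l≤u) ⟩
        l + (suc u ∸ l) % period  ≡⟨ cong (λ y → l + y % period) (+-∸-assoc 1 l≤u) ⟩
        l + suc (u ∸ l) % period  ≡⟨ cong (l +_) (%-suc (u ∸ l)) ⟩
        l + suc r % period        ∎
      advance : suc r < period → reduce u < k × reduce (suc u) ≡ suc (reduce u)
      advance 1+r<p = subst (_< k) (sym (reduce-≥ l≤u)) l+r<k , (begin
        reduce (suc u)      ≡⟨ reduce-1+u ⟩
        l + suc r % period  ≡⟨ cong (l +_) (m<n⇒m%n≡m 1+r<p) ⟩
        l + suc r           ≡⟨ +-suc l r ⟩
        suc (l + r)         ≡⟨ cong suc (reduce-≥ l≤u) ⟨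
        suc (reduce u)      ∎)
        where
        l+r<k : l + r < k
        l+r<k = s≤s⁻¹ (subst₂ _<_ (+-suc l r) l+period≡1+k (+-monoʳ-< l 1+r<p))
      wrap-around : suc r ≡ period → reduce u ≡ k × reduce (suc u) ≡ l
      wrap-around 1+r≡p =
          trans (reduce-≥ l≤u) (suc-injective (trans (sym (+-suc l r)) (trans (cong (l +_) 1+r≡p) l+period≡1+k)))
        , (begin
        reduce (suc u)       ≡⟨ reduce-1+u ⟩
        l + suc r % period   ≡⟨ cong (λ y → l + y % period) 1+r≡p ⟩
        l + period % period  ≡⟨ cong (l +_) (n%n≡0 period) ⟩
        l + 0                ≡⟨ +-identityʳ l ⟩
        l                    ∎)

  reduce-≤ : ∀ u → reduce u ≤ k
  reduce-≤ u = [ <⇒≤ ∘ proj₁ , ≤-reflexive ∘ proj₁ ]′ (reduce-suc u)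

  reduce-visits : ∀ {j} → l ≤ j → j ≤ k → ∀ u → ∃ λ u′ → u ≤ u′ × reduce u′ ≡ j
  reduce-visits {j} l≤j j≤k u = j + u * period , ≤-trans (m≤m*n u period) (m≤n+m _ j) , trans (reduce-repeat u) (reduce-id j≤k)
    where
    open ≡-Reasoning
    reduce-repeat : ∀ c → reduce (j + c * period) ≡ reduce j
    reduce-repeat zero = cong reduce (+-identityʳ j)
    reduce-repeat (suc c) = begin
      reduce (j + (period + c * period))  ≡⟨ cong reduce (trans (cong (j +_) (+-comm period (c * period))) (sym (+-assoc j _ period))) ⟩
      reduce (j + c * period + period)    ≡⟨ reduce-periodic (≤-trans l≤j (m≤m+n j _)) ⟩
      reduce (j + c * period)             ≡⟨ reduce-repeat c ⟩
      reduce j                            ∎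

  1+[l-1]≡l : suc (l ∸ 1) ≡ l
  1+[l-1]≡l = suc-pred l {{>-nonZero 0<l}}

  l-1<k : l ∸ 1 < k
  l-1<k = subst (_≤ k) (sym 1+[l-1]≡l) l≤k

  module _ {AP : Set} (M : Kripke AP) where
    open Kripke M using (n; T)

    lasso-periodic : (s : ℕ → State n) → ∀ m → l ≤ m → s (reduce (m + period)) ≡ s (reduce m)
    lasso-periodic s m l≤m = cong s (reduce-periodic l≤m)

    lasso-IsLoop : (s : ℕ → State n) → s (l ∸ 1) ≡ s k → IsLoop M (s ∘ reduce) k l
    lasso-IsLoop s s[l-1]≡s[k] =
        0<l , l≤k
      , trans (cong s (reduce-id (<⇒≤ l-1<k))) (trans s[l-1]≡s[k] (cong s (sym (reduce-id ≤-refl))))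
      , lasso-periodic s

    lasso-IsPath : (s : ℕ → State n) → (∀ {i} → i < k → T (s i) (s (suc i))) → s (l ∸ 1) ≡ s k → IsPath M (s ∘ reduce)
    lasso-IsPath s step s[l-1]≡s[k] u with reduce-suc u
    ... | inj₁ (r<k , next≡) = subst (T (s (reduce u)) ∘ s) (sym next≡) (step r<k)
    ... | inj₂ (r≡k , next≡) =
      subst₂ (λ x y → T (s x) (s y)) (sym r≡k) (sym next≡) (subst₂ (λ x y → T x (s y)) s[l-1]≡s[k] 1+[l-1]≡l (step l-1<k))

    record HintikkaLasso (ψ : LTL AP) (s : ℕ → State n) (L : Labelling M) : Set where
      field
        consistent : ∀ {φ} → φ ∈ cl ψ → ∀ {i} → i ≤ k → L i φ → Expand M L s i φ
        wraps      : ∀ {φ} → φ ∈ cl ψ → L (suc k) φ → L l φ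
        fulfils    : ∀ {a b} → a Uₗ b ∈ cl ψ → ∃ λ m → l ≤ m × m ≤ k × (L m b ⊎ ¬ L m (a Uₗ b))

    hintikka-lasso-sound : ∀ {ψ s L} → HintikkaLasso ψ s L → ∀ {φ} → φ ∈ cl ψ → ∀ {u} → L (reduce u) φ → Sat M (s ∘ reduce) u φ
    hintikka-lasso-sound {ψ} {s} {L} H = hintikka-sound M consistent′ fair′
      where
      open HintikkaLasso H
      consistent′ : Consistent M ψ (s ∘ reduce) (L ∘ reduce)
      consistent′ {φ} φ∈ u l = Expand-map M φ refl id next (consistent φ∈ (reduce-≤ u) l)
        where
        next : ∀ {x} → x ∈ cl φ → L (suc (reduce u)) x → L (reduce (suc u)) x
        next {x} x∈ lx with reduce-suc u
        ... | inj₁ (_ , next≡) = subst (λ i → L i x) (sym next≡) lx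
        ... | inj₂ (r≡k , next≡) =
          subst (λ i → L i x) (sym next≡) (wraps (cl-trans ψ x∈ φ∈) (subst (λ i → L (suc i) x) r≡k lx))
      fair′ : Fair M ψ (L ∘ reduce)
      fair′ {a} {b} U∈ u =
        let m , l≤m , m≤k , fulfilled = fulfils U∈
            u′ , u≤u′ , reduce≡m = reduce-visits l≤m m≤k u
        in u′ , u≤u′ , subst (λ i → L i b ⊎ ¬ L i (a Uₗ b)) (sym reduce≡m) fulfilled

  beyond-period : ∀ {i j} → i + suc k ≤ j → i + l ≤ j ∸ period
  beyond-period {i} {j} i+1+k≤j = begin
    i + l                     ≡⟨ cong (i +_) 1+k∸period≡l ⟨
    i + (suc k ∸ period)      ≡⟨ +-∸-assoc i (m∸n≤m (suc k) l) ⟨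
    i + suc k ∸ period        ≤⟨ ∸-monoˡ-≤ period i+1+k≤j ⟩
    j ∸ period                ∎
    where open ≤-Reasoning

  period≤ : ∀ i → period ≤ i + suc k
  period≤ i = ≤-trans (m∸n≤m (suc k) l) (m≤n+m (suc k) i)

  module Loop {AP : Set} (M : Kripke AP) {π : Path M} (periodic : ∀ m → l ≤ m → π (m + period) ≡ π m) where
    open Kripke M using (label)
  
    Agree-period : ∀ {m} → l ≤ m → Agree M π (m + period) π m
    Agree-period {m} l≤m = agree λ d →
      trans (cong π (trans (+-assoc m period d) (trans (cong (m +_) (+-comm period d)) (sym (+-assoc m d period)))))
            (periodic (m + d) (≤-trans l≤m (m≤m+n m d)))

    Sat-down : ∀ φ {j} → suc k ≤ j → Sat M π j φ → Sat M π (j ∸ period) φ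
    Sat-down φ {j} 1+k≤j s =
      Sat-shift M φ (Agree-period (beyond-period 1+k≤j)) (subst (λ x → Sat M π x φ) (sym (m∸n+n≡m (≤-trans (period≤ 0) 1+k≤j))) s)

    Sat-up : ∀ φ {j} → suc k ≤ j → Sat M π (j ∸ period) φ → Sat M π j φ
    Sat-up φ {j} 1+k≤j s =
      subst (λ x → Sat M π x φ) (m∸n+n≡m (≤-trans (period≤ 0) 1+k≤j)) (Sat-shift M φ (Agree-sym M (Agree-period (beyond-period 1+k≤j))) s)

    Sat-wrap : ∀ φ → Sat M π (suc k) φ ⇔ Sat M π l φ
    Sat-wrap φ = mk⇔ (subst (λ x → Sat M π x φ) 1+k∸period≡l ∘ Sat-down φ ≤-refl)
                     (Sat-up φ ≤-refl ∘ subst (λ x → Sat M π x φ) (sym 1+k∸period≡l))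

    Until? : ∀ {a b} → (∀ j → Dec (Sat M π j a)) → (∀ j → Dec (Sat M π j b)) → ∀ i → Dec (Sat M π i (a Uₗ b))
    Until? {a} {b} a? b? i =
      map′ (λ (j , _ , w) → j , w) (λ (j , w) → witness-below 0<period (period≤ i) shrink w) (anyUpTo? witness? (i + suc k))
      where
      Witness : ℕ → Set
      Witness j = i ≤ j × Sat M π j b × (∀ m → i ≤ m → m < j → Sat M π m a)
      witness? : ∀ j → Dec (Witness j)
      witness? j = (i ≤? j) ×-dec (b? j ×-dec all-between? a? i j)
      shrink : ∀ {j} → i + suc k ≤ j → Witness j → Witness (j ∸ period)
      shrink {j} c≤j (_ , sb , sa) =
          m+n≤o⇒m≤o i (beyond-period c≤j) , Sat-down b (m+n≤o⇒n≤o i c≤j) sb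
        , λ m i≤m m<j-p → sa m i≤m (<-≤-trans m<j-p (m∸n≤m j period))

    Release? : ∀ {a b} → (∀ j → Dec (Sat M π j a)) → (∀ j → Dec (Sat M π j b)) → ∀ i → Dec (Sat M π i (a Rₗ b))
    Release? {a} {b} a? b? i =
      map′ (below⇒everywhere 0<period (period≤ i) grow) (λ s {j} _ → s j) (allUpTo? instance? (i + suc k))
      where
      Instance : ℕ → Set
      Instance j = i ≤ j → Sat M π j b ⊎ ∃ λ m → i ≤ m × m < j × Sat M π m a
      instance? : ∀ j → Dec (Instance j)
      instance? j = (i ≤? j) →-dec (b? j ⊎-dec any-between? a? i j)
      grow : ∀ {j} → i + suc k ≤ j → Instance (j ∸ period) → Instance j
      grow {j} c≤j earlier _ =
        ⊎.map (Sat-up b (m+n≤o⇒n≤o i c≤j)) (λ (m , i≤m , m<j-p , sa) → m , i≤m , <-≤-trans m<j-p (m∸n≤m j period) , sa)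
              (earlier (m+n≤o⇒m≤o i (beyond-period c≤j)))

    Sat? : ∀ φ i → Dec (Sat M π i φ)
    Sat? (pos p) i = eval (lookup (π i)) (label p) Bool.≟ true
    Sat? (neg p) i = eval (lookup (π i)) (label p) Bool.≟ false
    Sat? (a ∧ₗ b) i = Sat? a i ×-dec Sat? b i
    Sat? (a ∨ₗ b) i = Sat? a i ⊎-dec Sat? b i
    Sat? (Xₗ a) i = Sat? a (suc i)
    Sat? (a Uₗ b) = Until? {a} {b} (Sat? a) (Sat? b)
    Sat? (a Rₗ b) = Release? {a} {b} (Sat? a) (Sat? b)

    eventually-in-loop : ∀ φ {j} → l ≤ j → Sat M π j φ → ∃ λ m → l ≤ m × m ≤ k × Sat M π m φ
    eventually-in-loop φ l≤j s =
      let m , m<1+k , l≤m , sm = witness-below 0<period (period≤ 0) shrink (l≤j , s)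
      in m , l≤m , s≤s⁻¹ m<1+k , sm
      where
      shrink : ∀ {j} → suc k ≤ j → l ≤ j × Sat M π j φ → l ≤ j ∸ period × Sat M π (j ∸ period) φ
      shrink 1+k≤j (_ , s) = beyond-period 1+k≤j , Sat-down φ 1+k≤j s

    always-from-loop : ∀ φ → (∀ {m} → l ≤ m → m ≤ k → Sat M π m φ) → ∀ {j} → l ≤ j → Sat M π j φ
    always-from-loop φ in-loop {j} = below⇒everywhere 0<period (period≤ 0) grow (λ m<1+k l≤m → in-loop l≤m (s≤s⁻¹ m<1+k)) j
      where
      grow : ∀ {j} → suc k ≤ j → (l ≤ j ∸ period → Sat M π (j ∸ period) φ) → l ≤ j → Sat M π j φ
      grow 1+k≤j earlier _ = Sat-up φ 1+k≤j (earlier (beyond-period 1+k≤j))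

module _ {AP : Set} (M : Kripke AP) where
  open Kripke M using (n; init; label; I; T) renaming (trans to transition)

  Assignment : Set
  Assignment = Var M → Bool

  stateAt : Assignment → ℕ → State n
  stateAt σ i = tabulate (σ ∘ st i)

  Assigned : Assignment → Labelling M
  Assigned σ i φ = σ ⊨ᵖ varᵖ (fv φ i)

  eval-at : ∀ σ i φ → eval σ (at M i φ) ≡ eval (lookup (stateAt σ i)) φ
  eval-at σ i φ = trans (eval-rename σ (st i) φ) (eval-cong (sym ∘ lookup∘tabulate (σ ∘ st i)) φ)

  eval-step : ∀ σ j → eval σ (rename [ st j , st (suc j) ] transition)
                    ≡ eval [ lookup (stateAt σ j) , lookup (stateAt σ (suc j)) ] transition
  eval-step σ j = trans (eval-rename σ [ st j , st (suc j) ] transition) (eval-cong both transition)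
    where
    both : ∀ x → σ ([ st j , st (suc j) ] x) ≡ [ lookup (stateAt σ j) , lookup (stateAt σ (suc j)) ] x
    both (inj₁ x) = sym (lookup∘tabulate (σ ∘ st j) x)
    both (inj₂ x) = sym (lookup∘tabulate (σ ∘ st (suc j)) x)

  modelC-holds : ∀ {σ} k → σ ⊨ᵖ modelC M k ⇔ (I (stateAt σ 0) × (∀ {j} → j < k → T (stateAt σ j) (stateAt σ (suc j))))
  modelC-holds {σ} k = mk⇔
    (λ h → let hI , hT = to ∧ᵖ-holds h
           in trans (sym (eval-at σ 0 init)) (evaluates-true hI)
            , λ {j} j<k → trans (sym (eval-step σ j)) (evaluates-true (⋀⁻ step hT (∈-upTo⁺ j<k))))
    (λ (hI , hT) → from ∧ᵖ-holds
      ( holds (trans (eval-at σ 0 init) hI)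
      , ⋀⁺ step (upTo k) (λ j∈ → holds (trans (eval-step σ _) (hT (∈-upTo⁻ j∈))))))
    where
    step : ℕ → Prop (Var M)
    step j = rename [ st j , st (suc j) ] transition

  modelC-complete : ∀ {σ π} k → (∀ i → stateAt σ i ≡ π i) → InitialisedPath M π → σ ⊨ᵖ modelC M k
  modelC-complete k states (init , path) =
    from (modelC-holds k) (subst I (sym (states 0)) init , λ {j} _ → subst₂ T (sym (states j)) (sym (states (suc j))) (path j))

  expandᵖ : LTL AP → ℕ → Prop (Var M)
  expandᵖ (pos p) i = at M i (label p)
  expandᵖ (neg p) i = ¬ᵖ at M i (label p)
  expandᵖ (a ∧ₗ b) i = varᵖ (fv a i) ∧ᵖ varᵖ (fv b i)
  expandᵖ (a ∨ₗ b) i = varᵖ (fv a i) ∨ᵖ varᵖ (fv b i)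
  expandᵖ (Xₗ a) i = varᵖ (fv a (suc i))
  expandᵖ (a Uₗ b) i = varᵖ (fv b i) ∨ᵖ (varᵖ (fv a i) ∧ᵖ varᵖ (fv (a Uₗ b) (suc i)))
  expandᵖ (a Rₗ b) i = varᵖ (fv b i) ∧ᵖ (varᵖ (fv a i) ∨ᵖ varᵖ (fv (a Rₗ b) (suc i)))

  fC-expandᵖ : ∀ φ i → fC M φ i ≡ (varᵖ (fv φ i) ⇔ᵖ expandᵖ φ i)
  fC-expandᵖ (pos p) i = refl
  fC-expandᵖ (neg p) i = refl
  fC-expandᵖ (a ∧ₗ b) i = refl
  fC-expandᵖ (a ∨ₗ b) i = refl
  fC-expandᵖ (Xₗ a) i = refl
  fC-expandᵖ (a Uₗ b) i = refl
  fC-expandᵖ (a Rₗ b) i = refl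

  expandᵖ-holds : ∀ {σ} φ {i} → σ ⊨ᵖ expandᵖ φ i ⇔ Expand M (Assigned σ) (stateAt σ) i φ
  expandᵖ-holds {σ} (pos p) {i} =
    mk⇔ (λ (holds e) → trans (sym (eval-at σ i (label p))) e) (λ e → holds (trans (eval-at σ i (label p)) e))
  expandᵖ-holds {σ} (neg p) {i} =
    mk⇔ (λ h → trans (sym (eval-at σ i (label p))) (to ¬ᵖ-holds h)) (λ e → from ¬ᵖ-holds (trans (eval-at σ i (label p)) e))
  expandᵖ-holds (a ∧ₗ b) = ∧ᵖ-holds
  expandᵖ-holds (a ∨ₗ b) = ∨ᵖ-holds
  expandᵖ-holds (Xₗ a) = ⇔-id _
  expandᵖ-holds (a Uₗ b) = (⇔-id _ ⊎-⇔ ∧ᵖ-holds) ⇔-∘ ∨ᵖ-holds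
  expandᵖ-holds (a Rₗ b) = (⇔-id _ ×-⇔ ∨ᵖ-holds) ⇔-∘ ∧ᵖ-holds

  fC-sound : ∀ {σ} φ {i} → σ ⊨ᵖ fC M φ i → Assigned σ i φ → Expand M (Assigned σ) (stateAt σ) i φ
  fC-sound φ {i} h = to (expandᵖ-holds φ) ∘ to (to ⇔ᵖ-iff (subst (_ ⊨ᵖ_) (fC-expandᵖ φ i) h))

  fC-complete : ∀ {σ} φ {i} → (Assigned σ i φ ⇔ Expand M (Assigned σ) (stateAt σ) i φ) → σ ⊨ᵖ fC M φ i
  fC-complete φ {i} lab⇔expand =
    subst (_ ⊨ᵖ_) (sym (fC-expandᵖ φ i)) (from ⇔ᵖ-iff (⇔-sym (expandᵖ-holds φ) ⇔-∘ lab⇔expand))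

  formulaC-sound : ∀ {σ} ψ k {φ i} → σ ⊨ᵖ formulaC M ψ k → φ ∈ cl ψ → i ≤ k → Assigned σ i φ → Expand M (Assigned σ) (stateAt σ) i φ
  formulaC-sound ψ k {φ} h φ∈ i≤k =
    fC-sound φ (⋀⁻ (fC M φ) (⋀⁻ (λ φ → ⋀ (map (fC M φ) (upTo (suc k)))) h φ∈) (∈-upTo⁺ (s≤s i≤k)))

  formulaC-complete : ∀ {σ} ψ k (Tr : Labelling M) {s : ℕ → State n} → (∀ i → stateAt σ i ≡ s i) →
                      (∀ {i φ} → Assigned σ i φ ⇔ Tr i φ) →
                      (∀ {φ i} → φ ∈ cl ψ → i ≤ k → Tr i φ ⇔ Expand M Tr s i φ) →
                      σ ⊨ᵖ formulaC M ψ k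
  formulaC-complete {σ} ψ k Tr {s} states assigned unfolds =
    ⋀⁺ _ (cl ψ) λ φ∈ → ⋀⁺ _ (upTo (suc k)) λ i∈ → fC-complete _ (encoded (unfolds φ∈ (s≤s⁻¹ (∈-upTo⁻ i∈))))
    where
    encoded : ∀ {i φ} → (Tr i φ ⇔ Expand M Tr s i φ) → Assigned σ i φ ⇔ Expand M (Assigned σ) (stateAt σ) i φ
    encoded {i} {φ} tr⇔ =
      (mk⇔ (Expand-map M φ (sym (states i)) (from assigned) (λ _ → from assigned))
           (Expand-map M φ (states i) (to assigned) (λ _ → to assigned))
       ⇔-∘ tr⇔) ⇔-∘ assigned

  record EncodingHolds (σ : Assignment) (ψ : LTL AP) (k : ℕ) : Set where
    field
      model     : σ ⊨ᵖ modelC M k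
      loop      : σ ⊨ᵖ loopC M k
      last      : σ ⊨ᵖ lastC M ψ k
      formulas  : σ ⊨ᵖ formulaC M ψ k
      accepting : σ ⊨ᵖ acceptC M ψ k
      initially : σ ⊨ᵖ varᵖ (fv ψ 0)

  encode-holds : ∀ {σ ψ k} → σ ⊨ᵖ encode M ψ k ⇔ EncodingHolds σ ψ k
  encode-holds = mk⇔
    (λ h → let m , h = to ∧ᵖ-holds h ; lo , h = to ∧ᵖ-holds h ; la , h = to ∧ᵖ-holds h
               f , h = to ∧ᵖ-holds h ; a , i = to ∧ᵖ-holds h
           in record { model = m ; loop = lo ; last = la ; formulas = f ; accepting = a ; initially = i })
    (λ H → let open EncodingHolds H in
           from ∧ᵖ-holds (model , from ∧ᵖ-holds (loop , from ∧ᵖ-holds (last , from ∧ᵖ-holds (formulas ,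
           from ∧ᵖ-holds (accepting , initially))))))

  satisfiable : ∀ {σ ψ k} → EncodingHolds σ ψ k → Satisfiable (encode M ψ k)
  satisfiable {σ} H = σ , evaluates-true (from encode-holds H)

module LoopCompleteness {AP : Set} (M : Kripke AP) (ψ : LTL AP) {π : Path M} {k l : ℕ} (loop : IsLoop M π k l) where
  open Kripke M using (n)

  0<l : 0 < l
  0<l = proj₁ loop

  l≤k : l ≤ k
  l≤k = proj₁ (proj₂ loop)

  open Lasso 0<l l≤k
  open Loop M (proj₂ (proj₂ (proj₂ loop)))

  accepting : LTL AP → ℕ → Bool
  accepting (a Uₗ b) m = does (Sat? b m) ∨ not (does (Sat? (a Uₗ b) m))
  accepting (a Rₗ b) m = not (does (Sat? b m)) ∨ does (Sat? (a Rₗ b) m)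
  accepting _ _ = false

  -- The value given to ⟪Acc(φ)⟫_i: an accepting position in [l, i] has been passed.
  seen : LTL AP → ℕ → Bool
  seen φ zero = false
  seen φ (suc j) = seen φ j ∨ (does (l ≤? suc j) ∧ accepting φ (suc j))

  σ : Assignment M
  σ (st i x) = lookup (π i) x
  σ (lv i) = does (i ≟ l)
  σ (inLoop i) = does (l ≤? i)
  σ loopExists = true
  σ (fv φ i) = does (Sat? φ i)
  σ (acc φ i) = seen φ i

  states : ∀ i → stateAt M σ i ≡ π i
  states i = tabulate∘lookup (π i)

  l≤1+j⇔ : ∀ {j} → l ≤ suc j ⇔ (l ≤ j ⊎ suc j ≡ l)
  l≤1+j⇔ = mk⇔ (⊎.map s≤s⁻¹ sym ∘ m≤n⇒m<n∨m≡n) [ m≤n⇒m≤1+n , ≤-reflexive ∘ sym ]′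

  loopC-complete : σ ⊨ᵖ loopC M k
  loopC-complete = from ∧ᵖ-holds
    ( from ⇔ᵖ-holds (dec-false (0 ≟ l) (<⇒≢ 0<l))
    , from ∧ᵖ-holds
      ( from ⇔ᵖ-holds (dec-false (l ≤? 0) (<⇒≱ 0<l))
      , from ∧ᵖ-holds (⋀⁺ _ (upTo k) (λ {j} _ → step-holds j) , from ⇔ᵖ-holds (sym (dec-true (l ≤? k) l≤k)))))
    where
    closes : ∀ {j} → suc j ≡ l → π j ≡ π k
    closes refl = proj₁ (proj₂ (proj₂ loop))
    step-holds : ∀ j → σ ⊨ᵖ (varᵖ (lv (suc j)) ⇒ᵖ eqState M j k)
                         ∧ᵖ (varᵖ (inLoop (suc j)) ⇔ᵖ (varᵖ (inLoop j) ∨ᵖ varᵖ (lv (suc j))))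
                         ∧ᵖ (varᵖ (inLoop j) ⇒ᵖ ¬ᵖ varᵖ (lv (suc j)))
    step-holds j = from ∧ᵖ-holds
      ( from ⇒ᵖ-holds (λ (holds e) → ⋀⁺ _ (allFin n) λ {x} _ →
          from ⇔ᵖ-holds (cong (λ s → lookup s x) (closes (to (does-true (suc j ≟ l)) e))))
      , from ∧ᵖ-holds
        ( from ⇔ᵖ-holds (does-⇔ l≤1+j⇔ (l ≤? suc j) ((l ≤? j) ⊎-dec (suc j ≟ l)))
        , from ⇒ᵖ-holds (λ (holds e) → from ¬ᵖ-holds
            (dec-false (suc j ≟ l) (λ 1+j≡l → <⇒≢ (s≤s (to (does-true (l ≤? j)) e)) (sym 1+j≡l))))))

  lastC-complete : σ ⊨ᵖ lastC M ψ k
  lastC-complete = ⋀⁺ _ (cl ψ) λ {φ} _ → from ∧ᵖ-holds (holds refl , ⋀⁺ _ (upTo k) λ {j} _ →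
    from ⇒ᵖ-holds (λ (holds e) → from ⇔ᵖ-holds (wraps φ (to (does-true (suc j ≟ l)) e))))
    where
    wraps : ∀ φ {j} → suc j ≡ l → does (Sat? φ (suc k)) ≡ does (Sat? φ (suc j))
    wraps φ refl = does-⇔ (Sat-wrap φ) (Sat? φ (suc k)) (Sat? φ l)

  seen-intro : ∀ φ {m i} → l ≤ m → m ≤ i → accepting φ m ≡ true → seen φ i ≡ true
  seen-intro φ {i = zero} l≤m z≤n _ = contradiction l≤m (<⇒≱ 0<l)
  seen-intro φ {i = suc j} l≤m m≤1+j e with m≤n⇒m<n∨m≡n m≤1+j
  ... | inj₁ m<1+j = from (∨-true (seen φ j)) (inj₁ (seen-intro φ l≤m (s≤s⁻¹ m<1+j) e))
  ... | inj₂ refl = from (∨-true (seen φ j)) (inj₂ (from (∧-true _) (dec-true (l ≤? suc j) l≤m , e)))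

  until-accepting : ∀ {a b m} → Sat M π m b ⊎ ¬ Sat M π m (a Uₗ b) → accepting (a Uₗ b) m ≡ true
  until-accepting {a} {b} {m} = from (∨-true (does (Sat? b m))) ∘
    ⊎.map (dec-true (Sat? b m)) (from (not-true _) ∘ dec-false (Sat? (a Uₗ b) m))

  release-accepting : ∀ {a b m} → ¬ Sat M π m b ⊎ Sat M π m (a Rₗ b) → accepting (a Rₗ b) m ≡ true
  release-accepting {a} {b} {m} = from (∨-true (not (does (Sat? b m)))) ∘
    ⊎.map (from (not-true _) ∘ dec-false (Sat? b m)) (dec-true (Sat? (a Rₗ b) m))

  accepted? : ∀ φ → Dec (∃ λ m → l ≤ m × m < suc k × accepting φ m ≡ true)
  accepted? φ = any-between? (λ m → accepting φ m Bool.≟ true) l (suc k)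

  until-seen : ∀ a b → seen (a Uₗ b) k ≡ true
  until-seen a b with accepted? (a Uₗ b)
  ... | yes (m , l≤m , m<1+k , e) = seen-intro (a Uₗ b) l≤m (s≤s⁻¹ m<1+k) e
  ... | no none =
    let j , l≤j , sb , _ = pending
        m , l≤m , m≤k , sb′ = eventually-in-loop b l≤j sb
    in contradiction (m , l≤m , s≤s m≤k , until-accepting {a} {b} {m} (inj₁ sb′)) none
    where
    pending : Sat M π l (a Uₗ b)
    pending = decidable-stable (Sat? (a Uₗ b) l) λ ¬s → none (l , ≤-refl , s≤s l≤k , until-accepting {a} {b} {l} (inj₂ ¬s))

  release-seen : ∀ a b → seen (a Rₗ b) k ≡ true
  release-seen a b with accepted? (a Rₗ b)
  ... | yes (m , l≤m , m<1+k , e) = seen-intro (a Rₗ b) l≤m (s≤s⁻¹ m<1+k) e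
  ... | no none = contradiction (l , ≤-refl , s≤s l≤k , release-accepting {a} {b} {l} (inj₂ released)) none
    where
    invariant : ∀ {m} → l ≤ m → m ≤ k → Sat M π m b
    invariant {m} l≤m m≤k = decidable-stable (Sat? b m) λ ¬sb → none (m , l≤m , s≤s m≤k , release-accepting {a} {b} {m} (inj₁ ¬sb))
    released : Sat M π l (a Rₗ b)
    released j l≤j = inj₁ (always-from-loop b invariant l≤j)

  accC-complete : ∀ φ → σ ⊨ᵖ accC M φ k
  accC-complete (pos _) = holds refl
  accC-complete (neg _) = holds refl
  accC-complete (_ ∧ₗ _) = holds refl
  accC-complete (_ ∨ₗ _) = holds refl
  accC-complete (Xₗ _) = holds refl
  accC-complete (a Uₗ b) = from ∧ᵖ-holds (holds refl , from ∧ᵖ-holds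
    (from ⇒ᵖ-holds (λ _ → holds (until-seen a b)) , ⋀⁺ _ (upTo k) (λ _ → from ⇔ᵖ-holds refl)))
  accC-complete (a Rₗ b) = from ∧ᵖ-holds (holds refl , from ∧ᵖ-holds
    (from ⇒ᵖ-holds (λ _ → holds (release-seen a b)) , ⋀⁺ _ (upTo k) (λ _ → from ⇔ᵖ-holds refl)))

  loop-complete : InitialisedPath M π → Sat M π 0 ψ → Satisfiable (encode M ψ k)
  loop-complete initialised sat = satisfiable M {ψ = ψ} record
    { model     = modelC-complete M k states initialised
    ; loop      = loopC-complete
    ; last      = lastC-complete
    ; formulas  = formulaC-complete M ψ k (Sat M π) states (λ {j} {x} → does-true (Sat? x j) ⇔-∘ var-holds)
                    λ {φ} {i} _ _ → mk⇔ (Sat⇒Expand M φ (λ {x} _ → Sat? x i)) (Expand⇒Sat M φ)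
    ; accepting = ⋀⁺ _ (cl ψ) (λ {φ} _ → accC-complete φ)
    ; initially = holds (dec-true (Sat? ψ 0) sat)
    }

module _ {AP : Set} (M : Kripke AP) where
  open Kripke M using (n; I; T; label)

  module _ {π : Path M} {k : ℕ} where

    SatNL? : ∀ φ i → Dec (SatNL M π k i φ)
    SatNL? (pos p) i = eval (lookup (π i)) (label p) Bool.≟ true
    SatNL? (neg p) i = eval (lookup (π i)) (label p) Bool.≟ false
    SatNL? (a ∧ₗ b) i = SatNL? a i ×-dec SatNL? b i
    SatNL? (a ∨ₗ b) i = SatNL? a i ⊎-dec SatNL? b i
    SatNL? (Xₗ a) i = (suc i ≤? k) ×-dec SatNL? a (suc i)
    SatNL? (a Uₗ b) i =
      map′ (λ (j , i≤j , j<1+k , w) → j , i≤j , s≤s⁻¹ j<1+k , w) (λ (j , i≤j , j≤k , w) → j , i≤j , s≤s j≤k , w)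
           (any-between? (λ j → SatNL? b j ×-dec all-between? (λ m → SatNL? a m) i j) i (suc k))
    SatNL? (a Rₗ b) i =
      map′ (λ (j , i≤j , j<1+k , sa , sb) → j , i≤j , s≤s⁻¹ j<1+k , sa , λ m i≤m m≤j → sb m i≤m (s≤s m≤j))
           (λ (j , i≤j , j≤k , sa , sb) → j , i≤j , s≤s j≤k , sa , λ m i≤m m<1+j → sb m i≤m (s≤s⁻¹ m<1+j))
           (any-between? (λ j → SatNL? a j ×-dec all-between? (λ m → SatNL? b m) i (suc j)) i (suc k))

    Bounded : Labelling M
    Bounded i φ = i ≤ k × SatNL M π k i φ

    Bounded⇒Expand : ∀ φ {i} → Bounded i φ → Expand M Bounded π i φ
    Bounded⇒Expand (pos p) (_ , s) = s
    Bounded⇒Expand (neg p) (_ , s) = s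
    Bounded⇒Expand (a ∧ₗ b) (i≤k , sa , sb) = (i≤k , sa) , (i≤k , sb)
    Bounded⇒Expand (a ∨ₗ b) (i≤k , s) = ⊎.map (i≤k ,_) (i≤k ,_) s
    Bounded⇒Expand (Xₗ a) (_ , i<k , sa) = i<k , sa
    Bounded⇒Expand (a Uₗ b) {i} (i≤k , j , i≤j , j≤k , sb , sa) with m≤n⇒m<n∨m≡n i≤j
    ... | inj₂ refl = inj₁ (i≤k , sb)
    ... | inj₁ i<j = inj₂ ((i≤k , sa i ≤-refl i<j) , <-≤-trans i<j j≤k , j , i<j , j≤k , sb , λ m i<m → sa m (<⇒≤ i<m))
    Bounded⇒Expand (a Rₗ b) {i} (i≤k , j , i≤j , j≤k , sa , sb) with m≤n⇒m<n∨m≡n i≤j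
    ... | inj₂ refl = (i≤k , sb i ≤-refl ≤-refl) , inj₁ (i≤k , sa)
    ... | inj₁ i<j = (i≤k , sb i ≤-refl i≤j) , inj₂ (<-≤-trans i<j j≤k , j , i<j , j≤k , sa , λ m i<m → sb m (<⇒≤ i<m))

    Expand⇒Bounded : ∀ φ {i} → i ≤ k → Expand M Bounded π i φ → Bounded i φ
    Expand⇒Bounded (pos p) i≤k s = i≤k , s
    Expand⇒Bounded (neg p) i≤k s = i≤k , s
    Expand⇒Bounded (a ∧ₗ b) i≤k ((_ , sa) , (_ , sb)) = i≤k , sa , sb
    Expand⇒Bounded (a ∨ₗ b) i≤k s = i≤k , ⊎.map proj₂ proj₂ s
    Expand⇒Bounded (Xₗ a) i≤k (i<k , sa) = i≤k , i<k , sa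
    Expand⇒Bounded (a Uₗ b) {i} i≤k (inj₁ (_ , sb)) = i≤k , i , ≤-refl , i≤k , sb , λ m i≤m m<i → contradiction i≤m (<⇒≱ m<i)
    Expand⇒Bounded (a Uₗ b) {i} i≤k (inj₂ ((_ , sa) , (_ , j , i<j , j≤k , sb , sa′))) = i≤k , j , <⇒≤ i<j , j≤k , sb , before
      where
      before : ∀ m → i ≤ m → m < j → SatNL M π k m a
      before m i≤m m<j with m≤n⇒m<n∨m≡n i≤m
      ... | inj₁ i<m = sa′ m i<m m<j
      ... | inj₂ refl = sa
    Expand⇒Bounded (a Rₗ b) {i} i≤k ((_ , sb) , inj₁ (_ , sa)) =
      i≤k , i , ≤-refl , i≤k , sa , λ m i≤m m≤i → subst (λ x → SatNL M π k x b) (≤-antisym i≤m m≤i) sb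
    Expand⇒Bounded (a Rₗ b) {i} i≤k ((_ , sb) , inj₂ (_ , j , i<j , j≤k , sa , sb′)) = i≤k , j , <⇒≤ i<j , j≤k , sa , until
      where
      until : ∀ m → i ≤ m → m ≤ j → SatNL M π k m b
      until m i≤m m≤j with m≤n⇒m<n∨m≡n i≤m
      ... | inj₁ i<m = sb′ m i<m m≤j
      ... | inj₂ refl = sb

  bounded-complete : ∀ {π k} ψ → InitialisedPath M π → SatNL M π k 0 ψ → Satisfiable (encode M ψ k)
  bounded-complete {π} {k} ψ initialised sat = satisfiable M encoding-holds
    where
    σ : Assignment M
    σ (st i x) = lookup (π i) x
    σ (fv φ i) = does ((i ≤? k) ×-dec SatNL? φ i)
    σ _ = false

    states : ∀ i → stateAt M σ i ≡ π i
    states i = tabulate∘lookup (π i)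

    accC-complete : ∀ φ → σ ⊨ᵖ accC M φ k
    accC-complete (pos _) = holds refl
    accC-complete (neg _) = holds refl
    accC-complete (_ ∧ₗ _) = holds refl
    accC-complete (_ ∨ₗ _) = holds refl
    accC-complete (Xₗ _) = holds refl
    accC-complete (_ Uₗ _) = from ∧ᵖ-holds (holds refl , from ∧ᵖ-holds (holds refl , ⋀⁺ _ (upTo k) (λ _ → holds refl)))
    accC-complete (_ Rₗ _) = from ∧ᵖ-holds (holds refl , from ∧ᵖ-holds (holds refl , ⋀⁺ _ (upTo k) (λ _ → holds refl)))

    encoding-holds : EncodingHolds M σ ψ k
    encoding-holds = record
      { model     = modelC-complete M k states initialised
      ; loop      = from ∧ᵖ-holds (holds refl , from ∧ᵖ-holds (holds refl , from ∧ᵖ-holds (⋀⁺ _ (upTo k) (λ _ → holds refl) , holds refl)))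
      ; last      = ⋀⁺ _ (cl ψ) λ {φ} _ → from ∧ᵖ-holds
                      ( from ⇒ᵖ-holds (λ _ → from ⇔ᵖ-holds (dec-false ((suc k ≤? k) ×-dec SatNL? φ (suc k)) (λ (1+k≤k , _) → <-irrefl refl 1+k≤k)))
                      , ⋀⁺ _ (upTo k) (λ _ → holds refl))
      ; formulas  = formulaC-complete M ψ k Bounded states (λ {j} {x} → does-true ((j ≤? k) ×-dec SatNL? x j) ⇔-∘ var-holds)
                      λ {φ} _ i≤k → mk⇔ (Bounded⇒Expand φ) (Expand⇒Bounded φ i≤k)
      ; accepting = ⋀⁺ _ (cl ψ) (λ {φ} _ → accC-complete φ)
      ; initially = holds (dec-true ((0 ≤? k) ×-dec SatNL? ψ 0) (z≤n , sat))
      }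

module _ {AP : Set} (M : Kripke AP) where
  open Kripke M using (n; I; T)

  module LoopConstraints {σ : Assignment M} {k : ℕ} (h : σ ⊨ᵖ loopC M k) where

    private
      steps : σ ⊨ᵖ ⋀ (map (λ j → (varᵖ (lv (suc j)) ⇒ᵖ eqState M j k)
                                ∧ᵖ (varᵖ (inLoop (suc j)) ⇔ᵖ (varᵖ (inLoop j) ∨ᵖ varᵖ (lv (suc j))))
                                ∧ᵖ (varᵖ (inLoop j) ⇒ᵖ ¬ᵖ varᵖ (lv (suc j)))) (upTo k))
            × σ ⊨ᵖ varᵖ loopExists ⇔ᵖ varᵖ (inLoop k)
      steps = to ∧ᵖ-holds (proj₂ (to ∧ᵖ-holds (proj₂ (to ∧ᵖ-holds h))))

      step : ∀ {j} → j < k → σ ⊨ᵖ varᵖ (lv (suc j)) ⇒ᵖ eqState M j k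
                           × σ ⊨ᵖ (varᵖ (inLoop (suc j)) ⇔ᵖ (varᵖ (inLoop j) ∨ᵖ varᵖ (lv (suc j))))
                                ∧ᵖ (varᵖ (inLoop j) ⇒ᵖ ¬ᵖ varᵖ (lv (suc j)))
      step j<k = to ∧ᵖ-holds (⋀⁻ _ (proj₁ steps) (∈-upTo⁺ j<k))

    inLoop-0 : σ (inLoop 0) ≡ false
    inLoop-0 = to ⇔ᵖ-holds (proj₁ (to ∧ᵖ-holds (proj₂ (to ∧ᵖ-holds h))))

    loopExists≡inLoop : σ loopExists ≡ σ (inLoop k)
    loopExists≡inLoop = to ⇔ᵖ-holds (proj₂ steps)

    lv-closes : ∀ {j} → j < k → σ (lv (suc j)) ≡ true → stateAt M σ j ≡ stateAt M σ k
    lv-closes {j} j<k e = tabulate-cong λ x → to ⇔ᵖ-holds (⋀⁻ _ (to ⇒ᵖ-holds (proj₁ (step j<k)) (holds e)) (∈-allFin x))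

    inLoop-suc : ∀ {j} → j < k → σ (inLoop (suc j)) ≡ σ (inLoop j) ∨ σ (lv (suc j))
    inLoop-suc j<k = to ⇔ᵖ-holds (proj₁ (to ∧ᵖ-holds (proj₂ (step j<k))))

    inLoop⇒¬lv : ∀ {j} → j < k → σ (inLoop j) ≡ true → σ (lv (suc j)) ≡ false
    inLoop⇒¬lv j<k e = to ¬ᵖ-holds (to ⇒ᵖ-holds (proj₂ (to ∧ᵖ-holds (proj₂ (step j<k)))) (holds e))

    inLoop-mono : ∀ {m} m′ → m ≤ m′ → m′ ≤ k → σ (inLoop m) ≡ true → σ (inLoop m′) ≡ true
    inLoop-mono m′ m≤m′ m′≤k e with m≤n⇒m<n∨m≡n m≤m′
    ... | inj₂ refl = e
    inLoop-mono (suc j) _ 1+j≤k e | inj₁ m<1+j =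
      trans (inLoop-suc 1+j≤k) (from (∨-true _) (inj₁ (inLoop-mono j (s≤s⁻¹ m<1+j) (<⇒≤ 1+j≤k) e)))

    loop-start : ∀ m → m ≤ k → σ (inLoop m) ≡ true → ∃ λ j → 0 < j × j ≤ m × σ (lv j) ≡ true
    loop-start zero _ e = contradiction (trans (sym e) inLoop-0) λ ()
    loop-start (suc j) 1+j≤k e with to (∨-true (σ (inLoop j))) (trans (sym (inLoop-suc 1+j≤k)) e)
    ... | inj₁ e′ = let i , 0<i , i≤j , lv-i = loop-start j (<⇒≤ 1+j≤k) e′ in i , 0<i , m≤n⇒m≤1+n i≤j , lv-i
    ... | inj₂ e′ = suc j , z<s , ≤-refl , e′

    loop-entered : ∀ {l m} → 0 < l → l ≤ k → σ (lv l) ≡ true → σ (inLoop m) ≡ true → l ≤ m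
    loop-entered {suc j} _ 1+j≤k lv-l e = ≮⇒≥ λ m<1+j →
      contradiction (trans (sym lv-l) (inLoop⇒¬lv 1+j≤k (inLoop-mono j (s≤s⁻¹ m<1+j) (<⇒≤ 1+j≤k) e))) λ ()

  lastC-sound : ∀ {σ} ψ k {φ} → σ ⊨ᵖ lastC M ψ k → φ ∈ cl ψ →
                (σ loopExists ≡ false → σ (fv φ (suc k)) ≡ false)
              × (∀ {j} → j < k → σ (lv (suc j)) ≡ true → σ (fv φ (suc k)) ≡ σ (fv φ (suc j)))
  lastC-sound ψ k h φ∈ =
    let unlooped , looped = to ∧ᵖ-holds (⋀⁻ _ h φ∈)
    in (λ e → to ⇔ᵖ-holds (to ⇒ᵖ-holds unlooped (from ¬ᵖ-holds e)))
     , (λ j<k e → to ⇔ᵖ-holds (to ⇒ᵖ-holds (⋀⁻ _ looped (∈-upTo⁺ j<k)) (holds e)))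

  accC-sound : ∀ {σ k a b} → σ ⊨ᵖ accC M (a Uₗ b) k → σ loopExists ≡ true →
                    ∃ λ m → m ≤ k × σ (inLoop m) ≡ true × (σ (fv b m) ≡ true ⊎ σ (fv (a Uₗ b) m) ≡ false)
  accC-sound {σ} {k} {a} {b} h looped =
    let initial , h′ = to ∧ᵖ-holds h
        final , steps = to ∧ᵖ-holds h′
    in search (to ⇔ᵖ-holds initial) steps k ≤-refl (evaluates-true (to ⇒ᵖ-holds final (holds looped)))
    where
    search : σ (acc (a Uₗ b) 0) ≡ false → σ ⊨ᵖ ⋀ (map (λ j → varᵖ (acc (a Uₗ b) (suc j)) ⇔ᵖ (varᵖ (acc (a Uₗ b) j) ∨ᵖ
               (varᵖ (inLoop (suc j)) ∧ᵖ (varᵖ (fv b (suc j)) ∨ᵖ ¬ᵖ varᵖ (fv (a Uₗ b) (suc j)))))) (upTo k)) →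
             ∀ i → i ≤ k → σ (acc (a Uₗ b) i) ≡ true →
             ∃ λ m → m ≤ i × σ (inLoop m) ≡ true × (σ (fv b m) ≡ true ⊎ σ (fv (a Uₗ b) m) ≡ false)
    search acc-0 steps zero _ e = contradiction (trans (sym e) acc-0) λ ()
    search acc-0 steps (suc j) 1+j≤k e
      with to (∨-true _) (trans (sym (to ⇔ᵖ-holds (⋀⁻ _ steps (∈-upTo⁺ 1+j≤k)))) e)
    ... | inj₁ e′ = let m , m≤j , r = search acc-0 steps j (<⇒≤ 1+j≤k) e′ in m , m≤n⇒m≤1+n m≤j , r
    ... | inj₂ e′ = let in-loop , r = to (∧-true _) e′
                    in suc j , ≤-refl , in-loop , ⊎.map id (to (not-true _)) (to (∨-true _) r)

  module _ (s : ℕ → State n) (k : ℕ) where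
    open Kripke M using (total)

    extend : Path M
    extend zero = s 0
    extend (suc u) with suc u ≤? k
    ... | yes _ = s (suc u)
    ... | no _ = proj₁ (total (extend u))

    extend-≤ : ∀ {u} → u ≤ k → extend u ≡ s u
    extend-≤ {zero} _ = refl
    extend-≤ {suc u} 1+u≤k with suc u ≤? k
    ... | yes _ = refl
    ... | no 1+u≰k = contradiction 1+u≤k 1+u≰k

    extend-IsPath : (∀ {j} → j < k → T (s j) (s (suc j))) → IsPath M extend
    extend-IsPath step u with suc u ≤? k
    ... | yes 1+u≤k = subst (λ x → T x (s (suc u))) (sym (extend-≤ (<⇒≤ 1+u≤k))) (step 1+u≤k)
    ... | no _ = proj₂ (total (extend u))

  unlooped-sound : ∀ {σ ψ k} → EncodingHolds M σ ψ k → σ loopExists ≡ false → Σ (Path M) λ π → InitialisedPath M π × Sat M π 0 ψ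
  unlooped-sound {σ} {ψ} {k} H unlooped =
    extend s k , (subst I (sym (extend-≤ s k z≤n)) I-s₀ , extend-IsPath s k steps) ,
    hintikka-sound M consistent fair (cl-self ψ) (z≤n , initially)
    where
    open EncodingHolds H

    s : ℕ → State n
    s = stateAt M σ

    I-s₀ : I (s 0)
    I-s₀ = proj₁ (to (modelC-holds M k) model)

    steps : ∀ {j} → j < k → T (s j) (s (suc j))
    steps = proj₂ (to (modelC-holds M k) model)

    L : Labelling M
    L i φ = i ≤ k × Assigned M σ i φ

    consistent : Consistent M ψ (extend s k) L
    consistent {φ} φ∈ u (u≤k , l) = Expand-map M φ (sym (extend-≤ s k u≤k)) (u≤k ,_) next (formulaC-sound M ψ k formulas φ∈ u≤k l)
      where
      next : ∀ {x} → x ∈ cl φ → Assigned M σ (suc u) x → L (suc u) x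
      next x∈ lx with m≤n⇒m<n∨m≡n u≤k
      ... | inj₁ u<k = u<k , lx
      ... | inj₂ refl = contradiction (trans (sym (evaluates-true lx)) (proj₁ (lastC-sound ψ k last (cl-trans ψ x∈ φ∈)) unlooped)) λ ()

    fair : Fair M ψ L
    fair _ u = suc k + u , m≤n+m u (suc k) , inj₂ λ (1+k+u≤k , _) → <-irrefl refl (m+n≤o⇒m≤o (suc k) 1+k+u≤k)

  looped-sound : ∀ {σ ψ k} → EncodingHolds M σ ψ k → σ loopExists ≡ true → Σ (Path M) λ π → InitialisedPath M π × Sat M π 0 ψ
  looped-sound {σ} {ψ} {k} H looped =
    s ∘ reduce , (subst I (cong s (sym (reduce-id z≤n))) I-s₀ , lasso-IsPath M s steps closes) ,
    hintikka-lasso-sound M hintikka (cl-self ψ) (subst (λ i → Assigned M σ i ψ) (sym (reduce-id z≤n)) initially)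
    where
    open EncodingHolds H
    open LoopConstraints loop

    s : ℕ → State n
    s = stateAt M σ

    I-s₀ : I (s 0)
    I-s₀ = proj₁ (to (modelC-holds M k) model)

    steps : ∀ {j} → j < k → T (s j) (s (suc j))
    steps = proj₂ (to (modelC-holds M k) model)

    start : ∃ λ l → 0 < l × l ≤ k × σ (lv l) ≡ true
    start = loop-start k ≤-refl (trans (sym loopExists≡inLoop) looped)

    l : ℕ
    l = proj₁ start

    0<l : 0 < l
    0<l = proj₁ (proj₂ start)

    l≤k : l ≤ k
    l≤k = proj₁ (proj₂ (proj₂ start))

    lv-l : σ (lv l) ≡ true
    lv-l = proj₂ (proj₂ (proj₂ start))

    open Lasso 0<l l≤k

    lv-1+[l-1] : σ (lv (suc (l ∸ 1))) ≡ true
    lv-1+[l-1] = subst (λ j → σ (lv j) ≡ true) (sym 1+[l-1]≡l) lv-l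

    closes : s (l ∸ 1) ≡ s k
    closes = lv-closes l-1<k lv-1+[l-1]

    hintikka : HintikkaLasso M ψ s (Assigned M σ)
    hintikka = record
      { consistent = λ φ∈ i≤k → formulaC-sound M ψ k formulas φ∈ i≤k
      ; wraps      = λ {φ} φ∈ (holds e) → holds (subst (λ j → σ (fv φ j) ≡ true) 1+[l-1]≡l
                       (trans (sym (proj₂ (lastC-sound ψ k last φ∈) l-1<k lv-1+[l-1])) e))
      ; fulfils    = λ {a} {b} U∈ →
          let m , m≤k , in-loop , fulfilled = accC-sound (⋀⁻ _ accepting U∈) looped
          in m , loop-entered 0<l l≤k lv-l in-loop , m≤k , ⊎.map holds (λ e (holds e′) → contradiction (trans (sym e′) e) λ ()) fulfilled
      }

  sound : ∀ ψ → (Σ ℕ λ k → Satisfiable (encode M ψ k)) → Σ (Path M) λ π → InitialisedPath M π × Sat M π 0 ψ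
  sound ψ (k , σ , e) = by-loop (σ loopExists) refl
    where
    H : EncodingHolds M σ ψ k
    H = to (encode-holds M) (holds e)
    by-loop : ∀ b → σ loopExists ≡ b → Σ (Path M) λ π → InitialisedPath M π × Sat M π 0 ψ
    by-loop true = looped-sound H
    by-loop false = unlooped-sound H

module _ {AP : Set} (M : Kripke AP) where
  open Kripke M using (n; I; T; init) renaming (trans to transition)

  SatisfyingLasso : LTL AP → ∀ {k l} → 0 < l → l ≤ k → Vec (State n) (suc k) → Set
  SatisfyingLasso ψ {k} {l} 0<l l≤k sv =
      sv ‼ (l ∸ 1) ≡ sv ‼ k × I (sv ‼ 0) × (∀ {i} → i < k → T (sv ‼ i) (sv ‼ suc i))
    × Sat M ((sv ‼_) ∘ Lasso.reduce 0<l l≤k) 0 ψ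

  ShortLasso : LTL AP → ℕ → Set
  ShortLasso ψ B = ∃ λ k → k < suc B × ∃ λ l → l < suc k × ∃ λ sv → Σ (0 < l) λ 0<l → Σ (l ≤ k) λ l≤k → SatisfyingLasso ψ 0<l l≤k sv

  SatisfyingLasso? : ∀ ψ {k l} (0<l : 0 < l) (l≤k : l ≤ k) sv → Dec (SatisfyingLasso ψ 0<l l≤k sv)
  SatisfyingLasso? ψ {k} {l} 0<l l≤k sv =
    ≡-dec Bool._≟_ (sv ‼ (l ∸ 1)) (sv ‼ k) ×-dec eval (lookup (sv ‼ 0)) init Bool.≟ true
    ×-dec allUpTo? (λ i → eval [ lookup (sv ‼ i) , lookup (sv ‼ suc i) ] transition Bool.≟ true) k
    ×-dec Loop.Sat? M (lasso-periodic M (sv ‼_)) ψ 0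
    where open Lasso 0<l l≤k

  ShortLasso? : ∀ ψ B → Dec (ShortLasso ψ B)
  ShortLasso? ψ B = anyUpTo? (λ k → anyUpTo? (λ l → Vec-searchable anySubset? (suc k) (lasso? k l)) (suc k)) (suc B)
    where
    lasso? : ∀ k l sv → Dec (Σ (0 < l) λ 0<l → Σ (l ≤ k) λ l≤k → SatisfyingLasso ψ 0<l l≤k sv)
    lasso? k l sv with 0 <? l | l ≤? k
    ... | no ¬0<l | _ = no (¬0<l ∘ proj₁)
    ... | yes _ | no l≰k = no (l≰k ∘ proj₁ ∘ proj₂)
    ... | yes 0<l | yes l≤k =
      map′ (λ r → 0<l , l≤k , r) (λ (p , q , r) → subst₂ (λ p q → SatisfyingLasso ψ p q sv) (≤-irrelevant p 0<l) (≤-irrelevant q l≤k) r)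
           (SatisfyingLasso? ψ 0<l l≤k sv)

  short-lasso-complete : ∀ ψ {B} → ShortLasso ψ B → Σ ℕ λ k → Satisfiable (encode M ψ k)
  short-lasso-complete ψ (k , _ , l , _ , sv , 0<l , l≤k , closes , init , steps , sat) =
    k , LoopCompleteness.loop-complete M ψ (lasso-IsLoop M (sv ‼_) closes)
                        (subst I (cong (sv ‼_) (sym (reduce-id z≤n))) init , lasso-IsPath M (sv ‼_) steps closes) sat
    where open Lasso 0<l l≤k

module ShortLassos {AP : Set} (M : Kripke AP) {π : Path M} (path : IsPath M π) (ψ : LTL AP) where
  open Kripke M using (n; I; T)
  open RawMonad (¬¬-Monad {0ℓ})

  Fulfils : ℕ → LTL AP → Set
  Fulfils f (a Uₗ b) = Sat M π f b ⊎ ¬ Sat M π f (a Uₗ b)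
  Fulfils f (pos _) = ⊤
  Fulfils f (neg _) = ⊤
  Fulfils f (_ ∧ₗ _) = ⊤
  Fulfils f (_ ∨ₗ _) = ⊤
  Fulfils f (Xₗ _) = ⊤
  Fulfils f (_ Rₗ _) = ⊤

  Goal : ℕ → ℕ → LTL AP → Set
  Goal a b φ = ∃ λ f → a ≤ f × f < b × Fulfils f φ

  Fulfilled : ℕ → ℕ → Set
  Fulfilled a b = All (Goal a b) (cl ψ)

  Progress : ℕ → ℕ → Set
  Progress a b = a < b × Fulfilled a b

  widen : ∀ {a b b′ φ} → b ≤ b′ → Goal a b φ → Goal a b′ φ
  widen b≤b′ (f , a≤f , f<b , ok) = f , a≤f , <-≤-trans f<b b≤b′ , ok

  progress-trans : ∀ {a b c} → Progress a b → Progress b c → Progress a c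
  progress-trans (a<b , F) (b<c , _) = <-trans a<b b<c , All.map (widen (<⇒≤ b<c)) F

  eventually-fulfils : ∀ m φ → ¬ ¬ (∃ λ f → m ≤ f × Fulfils f φ)
  eventually-fulfils m (a Uₗ b) = do
    decision ← ¬¬-excluded-middle {A = Sat M π m (a Uₗ b)}
    return (case decision of λ where
      (yes (j , m≤j , sb , _)) → j , m≤j , inj₁ sb
      (no ¬s) → m , ≤-refl , inj₂ ¬s)
  eventually-fulfils m (pos _) = return (m , ≤-refl , tt)
  eventually-fulfils m (neg _) = return (m , ≤-refl , tt)
  eventually-fulfils m (_ ∧ₗ _) = return (m , ≤-refl , tt)
  eventually-fulfils m (_ ∨ₗ _) = return (m , ≤-refl , tt)
  eventually-fulfils m (Xₗ _) = return (m , ≤-refl , tt)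
  eventually-fulfils m (_ Rₗ _) = return (m , ≤-refl , tt)

  collect : ∀ {m xs} → All (λ φ → ∃ λ f → m ≤ f × Fulfils f φ) xs → ∃ λ b → m < b × All (Goal m b) xs
  collect {m} [] = suc m , ≤-refl , []
  collect ((f , m≤f , ok) ∷ goals) =
    let b , m<b , G = collect goals
    in suc f ⊔ b , <-≤-trans m<b (m≤n⊔m (suc f) b) , (f , m≤f , m≤m⊔n (suc f) b , ok) ∷ All.map (widen (m≤n⊔m (suc f) b)) G

  progress : ∀ m → ¬ ¬ ∃ (Progress m)
  progress m = collect <$> All.sequenceM 0ℓ ¬¬-Monad (All.tabulate λ {φ} _ → eventually-fulfils m φ)

  -- The positions are listed latest first.
  chain : ∀ r → ¬ ¬ Σ (Vec ℕ (suc r)) (Linked (flip Progress))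
  chain zero = return (0 ∷ [] , [-])
  chain (suc r) = do
    (m ∷ ms , linked) ← chain r
    (m′ , m→m′) ← progress m
    return (m′ ∷ m ∷ ms , m→m′ ∷ linked)

  Table : ℕ → Set
  Table K = ∀ {u} → u ≤ K → All (λ φ → Dec (Sat M π u φ)) (cl ψ)

  table : ∀ K → ¬ ¬ Table K
  table K = do
    decisions ← All.sequenceM 0ℓ ¬¬-Monad (All.tabulate {xs = upTo (suc K)} λ {u} _ → decide-all u)
    return λ {u} u≤K → All.lookup decisions (∈-upTo⁺ (s≤s u≤K))
    where
    decide-all : ∀ u → ¬ ¬ All (λ φ → Dec (Sat M π u φ)) (cl ψ)
    decide-all u = All.sequenceM 0ℓ ¬¬-Monad (All.tabulate λ _ → ¬¬-excluded-middle)

  Type : Set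
  Type = State n × Vec Bool (length (cl ψ))

  types : ℕ
  types = 2 ^ n * 2 ^ length (cl ψ)

  code : Type → Fin types
  code (s , t) = combine (encodeBits s) (encodeBits t)

  code-injective : ∀ {x y} → code x ≡ code y → x ≡ y
  code-injective {s , t} {s′ , t′} e =
    let s≡s′ , t≡t′ = combine-injective (encodeBits s) (encodeBits t) (encodeBits s′) (encodeBits t′) e
    in cong₂ _,_ (encodeBits-injective s≡s′) (encodeBits-injective t≡t′)

  truths : ∀ {u xs} → All (λ φ → Dec (Sat M π u φ)) xs → Vec Bool (length xs)
  truths [] = []
  truths (d ∷ ds) = does d ∷ truths ds

  truths-lookup : ∀ {u xs φ} (ds : All (λ φ → Dec (Sat M π u φ)) xs) (φ∈ : φ ∈ xs) →
                  lookup (truths ds) (index φ∈) ≡ does (All.lookup ds φ∈)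
  truths-lookup (d ∷ ds) (here refl) = refl
  truths-lookup (d ∷ ds) (there φ∈) = truths-lookup ds φ∈

  module Typed {K : ℕ} (G : Table K) where

    -- Truth values are only tabulated up to K; beyond K the second component is junk.
    τ : ℕ → Type
    τ u with u ≤? K
    ... | yes u≤K = π u , truths (G u≤K)
    ... | no _ = π u , replicate _ false

    τ-state : ∀ u → proj₁ (τ u) ≡ π u
    τ-state u with u ≤? K
    ... | yes _ = refl
    ... | no _ = refl

    τ-truths : ∀ {u} (u≤K : u ≤ K) → proj₂ (τ u) ≡ truths (G u≤K)
    τ-truths {u} u≤K with u ≤? K
    ... | yes u≤K′ = cong (truths ∘ G) (≤-irrelevant u≤K′ u≤K)
    ... | no u≰K = contradiction u≤K u≰K

    transfer : ∀ {u v φ} → u ≤ K → v ≤ K → τ u ≡ τ v → φ ∈ cl ψ → Sat M π u φ → Sat M π v φ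
    transfer {u} {v} u≤K v≤K τu≡τv φ∈ s = to (does-true (All.lookup (G v≤K) φ∈)) (begin
      does (All.lookup (G v≤K) φ∈)           ≡⟨ truths-lookup (G v≤K) φ∈ ⟨
      lookup (truths (G v≤K)) (index φ∈)     ≡⟨ cong (λ t → lookup t (index φ∈)) same-truths ⟨
      lookup (truths (G u≤K)) (index φ∈)     ≡⟨ truths-lookup (G u≤K) φ∈ ⟩
      does (All.lookup (G u≤K) φ∈)           ≡⟨ dec-true (All.lookup (G u≤K) φ∈) s ⟩
      true                                   ∎)
      where
      open ≡-Reasoning
      same-truths : truths (G u≤K) ≡ truths (G v≤K)
      same-truths = trans (sym (τ-truths u≤K)) (trans (cong proj₂ τu≡τv) (τ-truths v≤K))

    Edge : Type → Type → Set
    Edge x y = ∃ λ w → suc w ≤ K × τ w ≡ x × τ (suc w) ≡ y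

    segment : ∀ {p q} → p ≤ q → q ≤ K → Star Edge (τ p) (τ q)
    segment {p} {q} p≤q q≤K =
      let d , p+d≡q = m≤n⇒∃[o]m+o≡n p≤q
          d+p≡q = trans (+-comm d p) p+d≡q
      in subst (λ x → Star Edge (τ p) (τ x)) d+p≡q (steps d (subst (_≤ K) (sym d+p≡q) q≤K))
      where
      steps : ∀ d {p} → d + p ≤ K → Star Edge (τ p) (τ (d + p))
      steps zero _ = ε
      steps (suc d) 1+d+p≤K = steps d (<⇒≤ 1+d+p≤K) ◅◅ ((_ , 1+d+p≤K , refl , refl) ◅ ε)

    record Recurrence : Set where
      field
        a b       : ℕ
        a<b       : a < b
        b≤K       : b ≤ K
        same-type : τ a ≡ τ b
        fulfilled : Fulfilled a b

  latest-greatest : ∀ {r} {ms : Vec ℕ (suc r)} → Linked (flip Progress) ms → ∀ i → lookup ms i ≤ Vec.head ms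
  latest-greatest {ms = _ ∷ _} linked Fin.zero = ≤-refl
  latest-greatest {ms = ms} linked (Fin.suc i) =
    subst (lookup ms (Fin.suc i) ≤_) (head-lookup ms) (<⇒≤ (proj₁ (Linked.lookup⁺ (flip progress-trans) {i = Fin.zero} {j = Fin.suc i} linked z<s)))
    where
    head-lookup : ∀ {m} (xs : Vec ℕ (suc m)) → lookup xs Fin.zero ≡ Vec.head xs
    head-lookup (_ ∷ _) = refl

  recurrence-in : ∀ {ms : Vec ℕ (suc types)} → Linked (flip Progress) ms → (G : Table (Vec.head ms)) → Typed.Recurrence G
  recurrence-in {ms} linked G = record
    { a = lookup ms j ; b = lookup ms i ; a<b = proj₁ progressed ; b≤K = latest-greatest linked i
    ; same-type = sym (code-injective same-code) ; fulfilled = proj₂ progressed }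
    where
    open Typed G
    repetition : ∃₂ λ i j → i Fin.< j × code (τ (lookup ms i)) ≡ code (τ (lookup ms j))
    repetition = pigeonhole (n<1+n types) (code ∘ τ ∘ lookup ms)
    i j : Fin (suc types)
    i = proj₁ repetition
    j = proj₁ (proj₂ repetition)
    same-code : code (τ (lookup ms i)) ≡ code (τ (lookup ms j))
    same-code = proj₂ (proj₂ (proj₂ repetition))
    progressed : Progress (lookup ms j) (lookup ms i)
    progressed = Linked.lookup⁺ (flip progress-trans) linked (proj₁ (proj₂ (proj₂ repetition)))

  recurrence : ¬ ¬ ∃ λ K → Σ (Table K) Typed.Recurrence
  recurrence = do
    (ms , linked) ← chain types
    G ← table (Vec.head ms)
    return (Vec.head ms , (λ {u} → G {u}) , recurrence-in linked G)

  bound : ℕ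
  bound = types + length (cl ψ) * (types + types) + types

  module Unrolled {K : ℕ} {G : Table K} (R : Typed.Recurrence G) where
    open Typed G
    open Typed.Recurrence R
    open Walks {E = Edge}

    a≤K : a ≤ K
    a≤K = ≤-trans (<⇒≤ a<b) b≤K

    X : Type
    X = τ a

    opaque
      short : ∀ {x y} → Star Edge x y → Star Edge x y
      short w = proj₁ (shorten code code-injective w)

      short-len : ∀ {x y} (w : Star Edge x y) → len (short w) < types
      short-len w = proj₂ (shorten code code-injective w)

    back : ∀ {p} → p ≤ b → Star Edge (τ p) X
    back p≤b = subst (Star Edge _) (sym same-type) (segment p≤b b≤K)

    first : Edge X (τ (suc a))
    first = a , <-≤-trans a<b b≤K , refl , refl

    prefix : Star Edge (τ 0) X
    prefix = short (segment z≤n a≤K)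

    circuit : Star Edge X X
    circuit = first ◅ short (back a<b)

    detour : ∀ {φ} → Goal a b φ → Star Edge X X
    detour (f , a≤f , f<b , _) = short (segment a≤f (≤-trans (<⇒≤ f<b) b≤K)) ◅◅ short (back (<⇒≤ f<b))

    detours : ∀ {xs} → All (Goal a b) xs → Star Edge X X
    detours [] = ε
    detours (g ∷ gs) = detour g ◅◅ detours gs

    -- The loop goes once round a → a+1 → … → b and then, for every goal f, detours a → f → b; each
    -- piece is shortened to fewer than `types` edges. Repeating the first loop edge at the end of
    -- unrolled gives position k+1 a vertex, which becomes the successor of the last lasso position.
    cycle : Star Edge X X
    cycle = circuit ◅◅ detours fulfilled

    unrolled : Star Edge (τ 0) (τ (suc a))
    unrolled = prefix ◅◅ cycle ◅◅ (first ◅ ε)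

    k l : ℕ
    k = len cycle + len prefix
    l = suc (len prefix)

    t : ℕ → Type
    t = vertex unrolled

    t-cycle : ∀ j → t (j + len prefix) ≡ vertex (cycle ◅◅ (first ◅ ε)) j
    t-cycle j = trans (cong t (+-comm j (len prefix))) (vertex-◅◅ʳ prefix _ j)

    t-in-cycle : ∀ {j} → j ≤ len cycle → t (j + len prefix) ≡ vertex cycle j
    t-in-cycle j≤ = trans (t-cycle _) (vertex-◅◅ˡ cycle _ j≤)

    t-0 : t 0 ≡ τ 0
    t-0 = vertex-0 unrolled

    t-l∸1 : t (l ∸ 1) ≡ X
    t-l∸1 = trans (t-in-cycle z≤n) (vertex-0 cycle)

    t-k : t k ≡ X
    t-k = trans (t-in-cycle ≤-refl) (vertex-len cycle)

    t-l : t l ≡ τ (suc a)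
    t-l = trans (t-in-cycle (s≤s z≤n)) (trans (vertex-◅◅ˡ circuit _ (s≤s z≤n)) (vertex-0 (short (back a<b))))

    t-1+k : t (suc k) ≡ τ (suc a)
    t-1+k = trans (t-cycle (suc (len cycle))) (trans (cong (vertex (cycle ◅◅ _)) (+-comm 1 (len cycle))) (vertex-◅◅ʳ cycle _ 1))

    edge-at : ∀ {i} → i ≤ k → Edge (t i) (t (suc i))
    edge-at {i} i≤k = vertex-edge unrolled (≤-trans (s≤s i≤k) (≤-reflexive 1+k≡len))
      where
      open ≡-Reasoning
      1+k≡len : suc k ≡ len unrolled
      1+k≡len = begin
        suc (len cycle + len prefix)                ≡⟨ cong suc (+-comm (len cycle) (len prefix)) ⟩
        suc (len prefix + len cycle)                ≡⟨ +-suc (len prefix) (len cycle) ⟨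
        len prefix + suc (len cycle)                ≡⟨ cong (len prefix +_) (+-comm 1 (len cycle)) ⟩
        len prefix + (len cycle + len (first ◅ ε))  ≡⟨ cong (len prefix +_) (len-◅◅ cycle _) ⟨
        len prefix + len (cycle ◅◅ (first ◅ ε))     ≡⟨ len-◅◅ prefix _ ⟨
        len unrolled                                ∎

    detours-visit : ∀ {xs φ} (gs : All (Goal a b) xs) (φ∈ : φ ∈ xs) → Visits (detours gs) (τ (proj₁ (All.lookup gs φ∈)))
    detours-visit (g@(f , a≤f , f<b , _) ∷ gs) (here refl) =
      visits-◅◅ˡ (detours gs) (visits-◅◅ˡ (short (back (<⇒≤ f<b))) (visits-end (short (segment a≤f (≤-trans (<⇒≤ f<b) b≤K)))))
    detours-visit (g ∷ gs) (there φ∈) = visits-◅◅ʳ (detour g) (detours-visit gs φ∈)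

    0<l : 0 < l
    0<l = z<s

    l≤k : l ≤ k
    l≤k = +-monoˡ-≤ (len prefix) (s≤s z≤n)

    open Lasso 0<l l≤k using (reduce; reduce-id; reduce-≤; HintikkaLasso; hintikka-lasso-sound)

    s : ℕ → State n
    s = proj₁ ∘ t

    L : Labelling M
    L i φ = ∃ λ w → w ≤ K × τ w ≡ t i × Sat M π w φ

    state-at : ∀ {w i} → τ w ≡ t i → π w ≡ s i
    state-at {w} τw≡ti = trans (sym (τ-state w)) (cong proj₁ τw≡ti)

    expand-along : ∀ {i φ} → Edge (t i) (t (suc i)) → φ ∈ cl ψ → L i φ → Expand M L s i φ
    expand-along {i} {φ} (w₀ , 1+w₀≤K , τw₀≡ti , τ1+w₀≡t1+i) φ∈ (w , w≤K , τw≡ti , sat) =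
      Expand-map M φ (state-at τw₀≡ti) (λ sat → w₀ , w₀≤K , τw₀≡ti , sat) (λ _ sat → suc w₀ , 1+w₀≤K , τ1+w₀≡t1+i , sat)
                 (Sat⇒Expand M φ (λ x∈ → All.lookup (G w₀≤K) (cl-trans ψ x∈ φ∈)) (transfer w≤K w₀≤K (trans τw≡ti (sym τw₀≡ti)) φ∈ sat))
      where
      w₀≤K : w₀ ≤ K
      w₀≤K = <⇒≤ 1+w₀≤K

    fulfils : ∀ {x y} → x Uₗ y ∈ cl ψ → ∃ λ m → l ≤ m × m ≤ k × (L m y ⊎ ¬ L m (x Uₗ y))
    fulfils {x} {y} U∈ = j + len prefix , +-monoˡ-≤ (len prefix) (s≤s z≤n) , +-monoˡ-≤ (len prefix) j≤ , labelled fulfilment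
      where
      f : ℕ
      f = proj₁ (All.lookup fulfilled U∈)
      f≤K : f ≤ K
      f≤K = ≤-trans (<⇒≤ (proj₁ (proj₂ (proj₂ (All.lookup fulfilled U∈))))) b≤K
      fulfilment : Sat M π f y ⊎ ¬ Sat M π f (x Uₗ y)
      fulfilment = proj₂ (proj₂ (proj₂ (All.lookup fulfilled U∈)))
      visit : Visits cycle (τ f)
      visit = visits-◅◅ʳ circuit (detours-visit fulfilled U∈)
      j : ℕ
      j = proj₁ visit
      j≤ : j ≤ len cycle
      j≤ = proj₁ (proj₂ visit)
      t≡τf : t (j + len prefix) ≡ τ f
      t≡τf = trans (t-in-cycle j≤) (proj₂ (proj₂ visit))
      labelled : Sat M π f y ⊎ ¬ Sat M π f (x Uₗ y) → L (j + len prefix) y ⊎ ¬ L (j + len prefix) (x Uₗ y)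
      labelled (inj₁ sy) = inj₁ (f , f≤K , sym t≡τf , sy)
      labelled (inj₂ ¬s) = inj₂ λ p → ¬s (back-transfer p)
        where
        back-transfer : L (j + len prefix) (x Uₗ y) → Sat M π f (x Uₗ y)
        back-transfer (w , w≤K , τw≡t , sat) = transfer {φ = x Uₗ y} w≤K f≤K (trans τw≡t t≡τf) U∈ sat

    wraps : ∀ {φ} → L (suc k) φ → L l φ
    wraps (w , w≤K , τw≡t , sat) = w , w≤K , trans τw≡t (trans t-1+k (sym t-l)) , sat

    hintikka : HintikkaLasso M ψ s L
    hintikka = record
      { consistent = λ φ∈ i≤k → expand-along (edge-at i≤k) φ∈
      ; wraps      = λ {φ} _ → wraps {φ}
      ; fulfils    = fulfils
      }

    detour-len : ∀ {φ} (g : Goal a b φ) → len (detour g) ≤ types + types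
    detour-len _ = len-◅◅-≤ (<⇒≤ (short-len _)) (<⇒≤ (short-len _))

    detours-len : ∀ {xs} (gs : All (Goal a b) xs) → len (detours gs) ≤ length xs * (types + types)
    detours-len [] = z≤n
    detours-len (g ∷ gs) = len-◅◅-≤ (detour-len g) (detours-len gs)

    k≤bound : k ≤ bound
    k≤bound = +-mono-≤ (len-◅◅-≤ {w = circuit} (short-len (back a<b)) (detours-len fulfilled)) (<⇒≤ (short-len _))

    short-lasso : I (π 0) → Sat M π 0 ψ → ShortLasso M ψ bound
    short-lasso init sat = k , s≤s k≤bound , l , s≤s l≤k , sv , 0<l , l≤k , closes , initial , steps , lasso-sat
      where
      sv : Vec (State n) (suc k)
      sv = tabulate (s ∘ toℕ)
      sv≡s : ∀ {i} → i ≤ k → sv ‼ i ≡ s i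
      sv≡s = ‼-tabulate k s
      closes : sv ‼ (l ∸ 1) ≡ sv ‼ k
      closes = trans (sv≡s (<⇒≤ l≤k)) (trans (cong proj₁ (trans t-l∸1 (sym t-k))) (sym (sv≡s ≤-refl)))
      initial : I (sv ‼ 0)
      initial = subst I (sym (trans (sv≡s z≤n) (trans (cong proj₁ t-0) (τ-state 0)))) init
      steps : ∀ {i} → i < k → T (sv ‼ i) (sv ‼ suc i)
      steps i<k =
        let w₀ , _ , τw₀≡ti , τ1+w₀≡t1+i = edge-at (<⇒≤ i<k)
        in subst₂ T (trans (state-at τw₀≡ti) (sym (sv≡s (<⇒≤ i<k)))) (trans (state-at τ1+w₀≡t1+i) (sym (sv≡s i<k))) (path w₀)
      lasso-sat : Sat M ((sv ‼_) ∘ reduce) 0 ψ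
      lasso-sat = Sat-shift M ψ {i = 0} {i′ = 0} (agree λ d → sym (sv≡s (reduce-≤ d)))
                    (hintikka-lasso-sound M hintikka (cl-self ψ) (0 , z≤n , sym (trans (cong t (reduce-id z≤n)) t-0) , sat))

  short-lasso-exists : I (π 0) → Sat M π 0 ψ → ¬ ¬ ShortLasso M ψ bound
  short-lasso-exists init sat = (λ (_ , _ , R) → Unrolled.short-lasso R init sat) <$> recurrence

complete : ∀ {AP} (M : Kripke AP) (ψ : LTL AP) → (Σ (Path M) λ π → InitialisedPath M π × Sat M π 0 ψ) → Σ ℕ λ k → Satisfiable (encode M ψ k)
complete M ψ (π , (init , path) , sat) =
  short-lasso-complete M ψ (decidable-stable (ShortLasso? M ψ _) (ShortLassos.short-lasso-exists M path ψ init sat))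

theorem3p3 : {AP : Set} (M : Kripke AP) (ψ : LTL AP)
    → ((Σ (Path M) λ π → InitialisedPath M π × _⊨_ M π ψ)
         ⇔ (Σ ℕ λ k → Satisfiable (encode M ψ k)))
    × ((π : Path M) (k : ℕ) → InitialisedPath M π → _⊨[_]_ M π k ψ
         → Satisfiable (encode M ψ k))
theorem3p3 M ψ = mk⇔ (complete M ψ) (sound M ψ) , bounded
  where
  bounded : (π : Path M) (k : ℕ) → InitialisedPath M π → _⊨[_]_ M π k ψ → Satisfiable (encode M ψ k)
  bounded π k initialised (inj₁ (l , loop , sat)) = LoopCompleteness.loop-complete M ψ loop initialised sat
  bounded π k initialised (inj₂ sat) = bounded-complete M ψ initialised sat
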